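{- Let $G$ be a signed graph obtained by gluing two signed graphs $G_1,G_2$ along a complete signed graph with loops $B_n$; that is, $G_1$ and $G_2$ are induced subgraphs of $G$ with $G_1\cup G_2=G$ and $G_1\cap G_2=B_n$. Then: (1) $\chi(G,t)=\dfrac{\chi(G_1,t)\,\chi(G_2,t)}{\chi(B_n,t)}$; (2) if $G_1$ and $G_2$ are balanced chordal, then $G$ is balanced chordal.
   Context: A signed graph $G=(G^+,G^-,L_G)$ consists of simple graphs $G^+=(V_G,E_G^+)$, $G^-=(V_G,E_G^-)$ on a common finite vertex set and a loop set $L_G\subseteq V_G$. For $W\subseteq V_G$, $G[W]=(G^+[W],G^-[W],W\cap L_G)$ is the induced subgraph. $G_1\cup G_2=G$ means every vertex, positive edge, negative edge and loop of $G$ belongs to $G_1$ or $G_2$; $G_1\cap G_2$ is the signed graph on the common vertices with the common edges and loops. $B_n$ is the signed graph on $n$ vertices in which every pair of distinct vertices is joined by both a positive and a negative edge and every vertex has a loop. With $\Lambda_k=\{0,\pm1,\dots,\pm k\}$, a proper $k$-coloring is $\gamma:V_G\to\Lambda_k$ with $\gamma(u)\ne\gamma(v)$ for $\{u,v\}\in E_G^+$, $\gamma(u)\ne-\gamma(v)$ for $\{u,v\}\in E_G^-$, $\gamma(v)\ne0$ for $v\in L_G$; the chromatic polynomial $\chi(G,t)$ satisfies $\chi(G,2k+1)=$ number of proper $k$-colorings for all $k\ge1$. A cycle of length $k\ge3$ is a sequence of distinct vertices $v_1,\dots,v_k$ with edges $\{v_1,v_2\},\dots,\{v_k,v_1\}$,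 each positive or negative; it is balanced if it has an even number of negative edges. A balanced chord of a balanced cycle is an edge not in the cycle connecting two of its vertices and separating it into two balanced cycles; $G$ is balanced chordal if every balanced cycle of length at least four has a balanced chord. -}

module Defs where

open import Data.Bool using (Bool; true; false; not; _∧_; _∨_; if_then_else_)
open import Data.Nat as ℕ using (ℕ; zero; suc; _≤_; _<_)
open import Data.Nat.Divisibility using (_∣_)
open import Data.Fin as Fin using (Fin; toℕ)
open import Data.Fin.Properties using () renaming (_≟_ to _≟ᶠ_)
open import Data.Integer as ℤ using (ℤ; +_; _-_; -_)
open import Data.Integer.Properties using () renaming (_≟_ to _≟ℤ_)
open import Data.List using (List; []; _∷_; length; filterᵇ; map; concatMap; allFin; foldr)
open import Data.Vec.Functional using (Vector)
import Data.Vec.Functional as VF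
open import Data.Product using (Σ; ∃; _×_; _,_)
open import Data.Sum using (_⊎_)
open import Data.Empty using (⊥-elim)
open import Relation.Nullary using (yes; no)
open import Function.Definitions using (Injective)
open import Relation.Binary.PropositionalEquality using (_≡_; _≢_)
open import Relation.Nullary.Decidable using (⌊_⌋)

-- Signed graphs on the vertex set Fin n.
-- pos / neg : adjacency (Boolean-valued) of the simple graphs G⁺, G⁻;
-- loop : the loop set L_G.

record SGraph (n : ℕ) : Set where
  field
    posE     : Fin n → Fin n → Bool
    negE     : Fin n → Fin n → Bool
    loop     : Fin n → Bool
    pos-sym  : ∀ u v → posE u v ≡ posE v u
    neg-sym  : ∀ u v → negE u v ≡ negE v u
    pos-irr  : ∀ u → posE u u ≡ false
    neg-irr  : ∀ u → negE u u ≡ false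
open SGraph public

infix 4 _==_
_==_ : ∀ {n} → Fin n → Fin n → Bool
u == v = ⌊ u ≟ᶠ v ⌋

B : (n : ℕ) → SGraph n
B n = record
  { posE = λ u v → not (u == v)
  ; negE = λ u v → not (u == v)
  ; loop = λ _ → true
  ; pos-sym = sym'
  ; neg-sym = sym'
  ; pos-irr = irr
  ; neg-irr = irr
  }
  where
  open import Relation.Binary.PropositionalEquality using (refl; sym)
  sym' : ∀ u v → not (u == v) ≡ not (v == u)
  sym' u v with u ≟ᶠ v | v ≟ᶠ u
  ... | yes _ | yes _ = refl
  ... | no _  | no _  = refl
  ... | yes p | no q  = ⊥-elim (q (sym p))
  ... | no p  | yes q = ⊥-elim (p (sym q))
  irr : ∀ u → not (u == u) ≡ false
  irr u with u ≟ᶠ u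
  ... | yes _ = refl
  ... | no ¬p = ⊥-elim (¬p refl)

-- Colorings.  Λ_k = {0, ±1, …, ±k} is represented by Fin (2k+1),
-- the element c standing for the integer (toℕ c) - k.

Λ : ℕ → Set
Λ k = Fin (suc (k ℕ.+ k))

val : ∀ k → Λ k → ℤ
val k c = + toℕ c - + k

infix 4 _==ℤ_
_==ℤ_ : ℤ → ℤ → Bool
x ==ℤ y = ⌊ x ≟ℤ y ⌋


allᵇ : ∀ {A : Set} → (A → Bool) → List A → Bool
allᵇ p = foldr (λ x b → p x ∧ b) true

allFuns : (N m : ℕ) → List (Fin N → Fin m)
allFuns zero    m = (λ ()) ∷ []
allFuns (suc N) m =
  concatMap (λ c → map (λ f → c VF.∷ f) (allFuns N m)) (allFin m)

isProper : ∀ {N} (G : SGraph N) (k : ℕ) → (Fin N → Λ k) → Bool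
isProper {N} G k γ =
  allᵇ (λ u → allᵇ (λ v →
          (not (posE G u v) ∨ not (val k (γ u) ==ℤ val k (γ v)))
        ∧ (not (negE G u v) ∨ not (val k (γ u) ==ℤ - val k (γ v))))
        (allFin N)
      ∧ (not (loop G u) ∨ not (val k (γ u) ==ℤ + 0)))
    (allFin N)

numColorings : ∀ {N} → SGraph N → ℕ → ℕ
numColorings {N} G k = length (filterᵇ (isProper G k) (allFuns N (suc (k ℕ.+ k))))

-- Polynomials with integer coefficients (coefficient lists, constant
-- term first) and their evaluation.

Poly : Set
Poly = List ℤ

evalP : Poly → ℤ → ℤ
evalP []      t = + 0
evalP (a ∷ p) t = a ℤ.+ t ℤ.* evalP p t

IsChromPoly : ∀ {N} → SGraph N → Poly → Set
IsChromPoly G p = ∀ (k : ℕ) → 1 ≤ k → evalP p (+ suc (k ℕ.+ k)) ≡ + numColorings G k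

-- Gluing: G₁, G₂ induced subgraphs of G (given via injective
-- vertex embeddings), G₁ ∪ G₂ = G, G₁ ∩ G₂ = B_n.

InImage : ∀ {m N} → (Fin m → Fin N) → Fin N → Set
InImage f v = ∃ λ a → f a ≡ v

IsInducedEmb : ∀ {m N} → SGraph m → SGraph N → (Fin m → Fin N) → Set
IsInducedEmb H G f =
    Injective _≡_ _≡_ f
  × (∀ a b → posE H a b ≡ posE G (f a) (f b))
  × (∀ a b → negE H a b ≡ negE G (f a) (f b))
  × (∀ a → loop H a ≡ loop G (f a))

record Gluing {N n₁ n₂ : ℕ} (G : SGraph N) (G₁ : SGraph n₁) (G₂ : SGraph n₂) (n : ℕ) : Set where
  field
    f₁ : Fin n₁ → Fin N
    f₂ : Fin n₂ → Fin N
    h  : Fin n → Fin N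
    f₁-induced : IsInducedEmb G₁ G f₁
    f₂-induced : IsInducedEmb G₂ G f₂
    -- G₁ ∪ G₂ = G  (loops are then covered automatically, subgraphs being induced)
    cover-vertex : ∀ v → InImage f₁ v ⊎ InImage f₂ v
    cover-pos : ∀ u v → posE G u v ≡ true →
      (InImage f₁ u × InImage f₁ v) ⊎ (InImage f₂ u × InImage f₂ v)
    cover-neg : ∀ u v → negE G u v ≡ true →
      (InImage f₁ u × InImage f₁ v) ⊎ (InImage f₂ u × InImage f₂ v)
    h-induced : IsInducedEmb (B n) G h
    h-image₁ : ∀ v → InImage f₁ v → InImage f₂ v → InImage h v
    h-image₂ : ∀ v → InImage h v → InImage f₁ v × InImage f₂ v

data Sgn : Set where
  ⊕ ⊖ : Sgn

HasEdge : ∀ {N} → SGraph N → Sgn → Fin N → Fin N → Set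
HasEdge G ⊕ u v = posE G u v ≡ true
HasEdge G ⊖ u v = negE G u v ≡ true

isNeg : Sgn → Bool
isNeg ⊕ = false
isNeg ⊖ = true

next : ∀ {m} → Fin (suc m) → Fin (suc m)
next {m} i with toℕ i ℕ.<? m
... | yes p = Fin.fromℕ< (ℕ.s≤s p)
... | no _ = Fin.zero

-- A cycle of length k = 3 + m: distinct vertices v₀,…,v_{k-1}, edge i joins
-- v_i and v_{i+1 mod k} and has sign s_i.
record Cycle {N : ℕ} (G : SGraph N) (m : ℕ) : Set where
  field
    vert     : Fin (3 ℕ.+ m) → Fin N
    sgn      : Fin (3 ℕ.+ m) → Sgn
    distinct : Injective _≡_ _≡_ vert
    edges    : ∀ i → HasEdge G (sgn i) (vert i) (vert (next i))
open Cycle public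

negsIn : ∀ {k} → (Fin k → Sgn) → ℕ → ℕ → ℕ
negsIn {k} s a b =
  length (filterᵇ (λ i → isNeg (s i) ∧ ⌊ a ℕ.≤? toℕ i ⌋ ∧ ⌊ toℕ i ℕ.<? b ⌋) (allFin k))

Balanced : ∀ {N} {G : SGraph N} {m} → Cycle G m → Set
Balanced {m = m} C = 2 ∣ negsIn (sgn C) 0 (3 ℕ.+ m)

-- A balanced chord of C: an edge of sign σ joining v_i and v_j with
-- i < j, j - i ≥ 2 and (k - j) + i ≥ 2 (so it is not an edge of the cycle
-- and both parts v_i…v_j and v_j…v_{k-1},v_0…v_i are cycles of length ≥ 3),
-- such that both resulting cycles are balanced.
record BalancedChord {N : ℕ} {G : SGraph N} {m : ℕ} (C : Cycle G m) : Set where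
  field
    i j  : Fin (3 ℕ.+ m)
    σ    : Sgn
    gap₁ : 2 ℕ.+ toℕ i ≤ toℕ j
    gap₂ : 2 ℕ.+ toℕ j ≤ (3 ℕ.+ m) ℕ.+ toℕ i
    edge : HasEdge G σ (vert C i) (vert C j)
    bal₁ : 2 ∣ (negsIn (sgn C) (toℕ i) (toℕ j) ℕ.+ (if isNeg σ then 1 else 0))
    bal₂ : 2 ∣ (negsIn (sgn C) 0 (toℕ i) ℕ.+ negsIn (sgn C) (toℕ j) (3 ℕ.+ m)
                ℕ.+ (if isNeg σ then 1 else 0))

BalancedChordal : ∀ {N} → SGraph N → Set
BalancedChordal G = ∀ (m : ℕ) → 1 ≤ m → (C : Cycle G m) → Balanced C → BalancedChord C

module Submission where

-- (1) χ(G)·χ(B_n) = χ(G₁)·χ(G₂).  Both sides are integer polynomials, and a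
--     polynomial is determined by its values at the odd points 2k+1 (k ≥ 1), so it
--     suffices to count colourings.  Sort the colourings of G₁, G₂ by their restriction
--     β to the overlap and let e_i(β) be the number of proper colourings of G_i that
--     restrict to β.  Then #col(G_i) = Σ_β e_i(β), and #col(G) = Σ_β e₁(β)·e₂(β)
--     since a colouring of G is the same as a pair of colourings of G₁, G₂ agreeing on
--     the overlap.  Moreover e_i(β) = 0 unless β is a proper colouring of B_n, and e_i
--     is constant on those: the symmetries of Λ_k commuting with c ↦ −c act
--     transitively on proper colourings of B_n and preserve e_i.  The identity follows.
-- (2) Balanced chordality: a balanced cycle of length ≥ 4 lies in G₁ or G₂, where it
--     has a chord, or it crosses the overlap at two non-adjacent vertices; these are
--     joined by edges of both signs, and one of the two is a balanced chord.

open import Defs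
open import Data.Nat using (ℕ)
open import Data.Product using (_×_)
open import Relation.Binary.PropositionalEquality using (_≡_)

module Sums where
  open import Data.Bool using (Bool; true; false; _∧_)
  open import Data.Nat as ℕ using (ℕ; suc; _+_; _*_)
  import Data.Nat.Properties as ℕP
  open import Data.Nat.Tactic.RingSolver using (solve-∀)
  open import Data.Fin as Fin using (Fin)
  open import Data.List using (List; []; _∷_; _++_; map; concatMap; tabulate; allFin; length; filterᵇ)
  open import Relation.Binary.PropositionalEquality
  open import Function using (_∘_)

  S : ∀ {A : Set} → List A → (A → ℕ) → ℕ
  S []       f = 0
  S (x ∷ xs) f = f x + S xs f

  S-cong : ∀ {A : Set} (xs : List A) {f g : A → ℕ} → (∀ x → f x ≡ g x) → S xs f ≡ S xs g
  S-cong []       f≗g = refl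
  S-cong (x ∷ xs) f≗g = cong₂ _+_ (f≗g x) (S-cong xs f≗g)

  S-0 : ∀ {A : Set} (xs : List A) → S xs (λ _ → 0) ≡ 0
  S-0 []       = refl
  S-0 (x ∷ xs) = S-0 xs

  S-+ : ∀ {A : Set} (xs : List A) f g → S xs (λ x → f x + g x) ≡ S xs f + S xs g
  S-+ []       f g = refl
  S-+ (x ∷ xs) f g rewrite S-+ xs f g = interchange (f x) (g x) (S xs f) (S xs g)
    where
    interchange : ∀ a b c d → a + b + (c + d) ≡ a + c + (b + d)
    interchange = solve-∀

  S-*ˡ : ∀ {A : Set} (xs : List A) c f → S xs (λ x → c * f x) ≡ c * S xs f
  S-*ˡ []       c f = sym (ℕP.*-zeroʳ c)
  S-*ˡ (x ∷ xs) c f = trans (cong (c * f x +_) (S-*ˡ xs c f)) (sym (ℕP.*-distribˡ-+ c (f x) _))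

  S-*ʳ : ∀ {A : Set} (xs : List A) c f → S xs (λ x → f x * c) ≡ S xs f * c
  S-*ʳ xs c f = trans (S-cong xs (λ x → ℕP.*-comm (f x) c)) (trans (S-*ˡ xs c f) (ℕP.*-comm c _))

  S-*-S : ∀ {A B : Set} (xs : List A) (ys : List B) f g →
          S xs f * S ys g ≡ S xs (λ x → S ys (λ y → f x * g y))
  S-*-S xs ys f g = trans (sym (S-*ʳ xs (S ys g) f)) (S-cong xs (λ x → sym (S-*ˡ ys (f x) g)))

  S-swap : ∀ {A B : Set} (xs : List A) (ys : List B) (F : A → B → ℕ) →
           S xs (λ x → S ys (F x)) ≡ S ys (λ y → S xs (λ x → F x y))
  S-swap []       ys F = sym (S-0 ys)
  S-swap (x ∷ xs) ys F = trans (cong (S ys (F x) +_) (S-swap xs ys F)) (sym (S-+ ys (F x) _))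

  S-++ : ∀ {A : Set} (xs ys : List A) f → S (xs ++ ys) f ≡ S xs f + S ys f
  S-++ []       ys f = refl
  S-++ (x ∷ xs) ys f = trans (cong (f x +_) (S-++ xs ys f)) (sym (ℕP.+-assoc (f x) _ _))

  S-map : ∀ {A B : Set} (g : A → B) (xs : List A) f → S (map g xs) f ≡ S xs (f ∘ g)
  S-map g []       f = refl
  S-map g (x ∷ xs) f = cong (f (g x) +_) (S-map g xs f)

  S-concatMap : ∀ {A B : Set} (g : A → List B) (xs : List A) f →
                S (concatMap g xs) f ≡ S xs (λ x → S (g x) f)
  S-concatMap g []       f = refl
  S-concatMap g (x ∷ xs) f = trans (S-++ (g x) (concatMap g xs) f) (cong (S (g x) f +_) (S-concatMap g xs f))

  S-tabulate : ∀ {A : Set} {n} (h : Fin n → A) f → S (tabulate h) f ≡ S (allFin n) (f ∘ h)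
  S-tabulate {n = ℕ.zero} h f = refl
  S-tabulate {n = suc n}  h f =
    cong (f (h Fin.zero) +_) (trans (S-tabulate (h ∘ Fin.suc) f) (sym (S-tabulate Fin.suc (f ∘ h))))

  S-allFin-suc : ∀ {n} f → S (allFin (suc n)) f ≡ f Fin.zero + S (allFin n) (f ∘ Fin.suc)
  S-allFin-suc f = cong (f Fin.zero +_) (S-tabulate Fin.suc f)

  ind : Bool → ℕ
  ind true  = 1
  ind false = 0

  ind-∧ : ∀ a b → ind (a ∧ b) ≡ ind a * ind b
  ind-∧ true  b = sym (ℕP.+-identityʳ (ind b))
  ind-∧ false b = refl

  length-filter : ∀ {A : Set} (P : A → Bool) xs → length (filterᵇ P xs) ≡ S xs (ind ∘ P)
  length-filter P []       = refl
  length-filter P (x ∷ xs) with P x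
  ... | true  = cong suc (length-filter P xs)
  ... | false = length-filter P xs

  -- If e₁, e₂ vanish outside P and e₂ is constant on P, then
  -- (Σ e₁·e₂)·#P = (Σ e₁)·(Σ e₂): both sides are Σ_{x,y} e₁ x · e₂ y · [P y].
  product-formula : ∀ {A : Set} (xs : List A) (P : A → Bool) (e₁ e₂ : A → ℕ) →
    (∀ x → P x ≡ false → e₁ x ≡ 0) → (∀ x → P x ≡ false → e₂ x ≡ 0) →
    (∀ x y → P x ≡ true → P y ≡ true → e₂ x ≡ e₂ y) →
    S xs (λ x → e₁ x * e₂ x) * S xs (ind ∘ P) ≡ S xs e₁ * S xs e₂
  product-formula xs P e₁ e₂ vanish₁ vanish₂ constant₂ =
    trans (S-*-S xs xs _ _) (trans (S-cong xs λ x → S-cong xs (termwise x)) (sym (S-*-S xs xs e₁ e₂)))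
    where
    termwise : ∀ x y → e₁ x * e₂ x * ind (P y) ≡ e₁ x * e₂ y
    termwise x y with P x in Px | P y in Py
    ... | false | _     rewrite vanish₁ x Px = refl
    ... | true  | false rewrite vanish₂ y Py = trans (ℕP.*-zeroʳ (e₁ x * e₂ x)) (sym (ℕP.*-zeroʳ (e₁ x)))
    ... | true  | true  = trans (ℕP.*-identityʳ _) (cong (e₁ x *_) (constant₂ x y Px Py))

module Booleans where
  open import Data.Bool using (Bool; true; false; _∧_; _∨_; not)
  open import Data.Empty using (⊥; ⊥-elim)
  open import Data.Nat as ℕ using (suc)
  open import Data.Fin as Fin using (Fin)
  open import Data.List using (allFin; tabulate)
  open import Function using (_∘_; id)
  open import Relation.Nullary using (Dec; yes)
  open import Relation.Nullary.Decidable using (⌊_⌋; isYes≗does; dec-true; dec-false)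
  open import Relation.Binary.PropositionalEquality

  ⌊⌋-true : ∀ {P : Set} (d : Dec P) → P → ⌊ d ⌋ ≡ true
  ⌊⌋-true d p = trans (isYes≗does d) (dec-true d p)

  ⌊⌋-false : ∀ {P : Set} (d : Dec P) → (P → ⊥) → ⌊ d ⌋ ≡ false
  ⌊⌋-false d ¬p = trans (isYes≗does d) (dec-false d ¬p)

  ⌊⌋-sound : ∀ {P : Set} (d : Dec P) → ⌊ d ⌋ ≡ true → P
  ⌊⌋-sound (yes p) _ = p

  bool-ext : ∀ {a b : Bool} → (a ≡ true → b ≡ true) → (b ≡ true → a ≡ true) → a ≡ b
  bool-ext {false} {false} _ _ = refl
  bool-ext {false} {true}  _ b⇒a = b⇒a refl
  bool-ext {true}  {false} a⇒b _ = sym (a⇒b refl)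
  bool-ext {true}  {true}  _ _ = refl

  ∧-intro : ∀ {a b} → a ≡ true → b ≡ true → a ∧ b ≡ true
  ∧-intro refl refl = refl

  ∧-left : ∀ {a b} → a ∧ b ≡ true → a ≡ true
  ∧-left {true} _ = refl

  ∧-right : ∀ {a b} → a ∧ b ≡ true → b ≡ true
  ∧-right {true} b≡true = b≡true

  nand-intro : ∀ {a b} → (a ≡ true → b ≡ true → ⊥) → not a ∨ not b ≡ true
  nand-intro {false}         _ = refl
  nand-intro {true}  {false} _ = refl
  nand-intro {true}  {true}  ¬both = ⊥-elim (¬both refl refl)

  nand-elim : ∀ {a b} → not a ∨ not b ≡ true → a ≡ true → b ≡ true → ⊥
  nand-elim {true} {true} () refl refl

  allᵇ-sound : ∀ {n} (p : Fin n → Bool) → allᵇ p (allFin n) ≡ true → ∀ i → p i ≡ true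
  allᵇ-sound p = tabulated p id
    where
    tabulated : ∀ {A : Set} {n} (p : A → Bool) (h : Fin n → A) → allᵇ p (tabulate h) ≡ true →
                ∀ i → p (h i) ≡ true
    tabulated {n = suc n} p h all-p Fin.zero    = ∧-left all-p
    tabulated {n = suc n} p h all-p (Fin.suc i) = tabulated p (h ∘ Fin.suc) (∧-right {p (h Fin.zero)} all-p) i

  allᵇ-complete : ∀ {n} (p : Fin n → Bool) → (∀ i → p i ≡ true) → allᵇ p (allFin n) ≡ true
  allᵇ-complete p = tabulated p id
    where
    tabulated : ∀ {A : Set} {n} (p : A → Bool) (h : Fin n → A) → (∀ i → p (h i) ≡ true) →
                allᵇ p (tabulate h) ≡ true
    tabulated {n = ℕ.zero} p h _     = refl
    tabulated {n = suc n}  p h p∘h = ∧-intro (p∘h Fin.zero) (tabulated p (h ∘ Fin.suc) (p∘h ∘ Fin.suc))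

module Polynomials where
  open import Data.Nat as ℕ using (ℕ; zero; suc; _≤_; _<_; s≤s; z≤n)
  import Data.Nat.Properties as ℕP
  open import Data.Integer as ℤ using (ℤ; +_; _+_; _-_; _*_; -_; ∣_∣)
  import Data.Integer.Properties as ℤP
  open import Data.Integer.Tactic.RingSolver using (solve-∀)
  open import Data.List using ([]; _∷_; map)
  open import Data.Sum using (inj₁; inj₂)
  open import Data.Empty using (⊥-elim)
  open import Relation.Binary.PropositionalEquality
  open ≡-Reasoning

  addP : Poly → Poly → Poly
  addP []      q       = q
  addP (a ∷ p) []      = a ∷ p
  addP (a ∷ p) (b ∷ q) = (a + b) ∷ addP p q

  eval-addP : ∀ p q t → evalP (addP p q) t ≡ evalP p t + evalP q t
  eval-addP []      q       t = sym (ℤP.+-identityˡ _)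
  eval-addP (a ∷ p) []      t = sym (ℤP.+-identityʳ _)
  eval-addP (a ∷ p) (b ∷ q) t rewrite eval-addP p q t = shuffle a b t (evalP p t) (evalP q t)
    where
    shuffle : ∀ a b t x y → (a + b) + t * (x + y) ≡ (a + t * x) + (b + t * y)
    shuffle = solve-∀

  scaleP : ℤ → Poly → Poly
  scaleP c = map (c *_)

  eval-scaleP : ∀ c p t → evalP (scaleP c p) t ≡ c * evalP p t
  eval-scaleP c []      t = sym (ℤP.*-zeroʳ c)
  eval-scaleP c (a ∷ p) t rewrite eval-scaleP c p t = distrib c a t (evalP p t)
    where
    distrib : ∀ c a t x → c * a + t * (c * x) ≡ c * (a + t * x)
    distrib = solve-∀

  mulP : Poly → Poly → Poly
  mulP []      _ = []
  mulP (a ∷ p) q = addP (scaleP a q) (+ 0 ∷ mulP p q)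

  eval-mulP : ∀ p q t → evalP (mulP p q) t ≡ evalP p t * evalP q t
  eval-mulP []      q t = sym (ℤP.*-zeroˡ (evalP q t))
  eval-mulP (a ∷ p) q t
    rewrite eval-addP (scaleP a q) (+ 0 ∷ mulP p q) t | eval-scaleP a q t | eval-mulP p q t
    = distrib a t (evalP p t) (evalP q t)
    where
    distrib : ∀ a t x y → a * y + (+ 0 + t * (x * y)) ≡ (a + t * x) * y
    distrib = solve-∀

  subP : Poly → Poly → Poly
  subP p q = addP p (scaleP (- + 1) q)

  eval-subP : ∀ p q t → evalP (subP p q) t ≡ evalP p t - evalP q t
  eval-subP p q t = begin
    evalP (addP p (scaleP (- + 1) q)) t     ≡⟨ eval-addP p _ t ⟩
    evalP p t + evalP (scaleP (- + 1) q) t  ≡⟨ cong (_+_ (evalP p t)) (eval-scaleP (- + 1) q t) ⟩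
    evalP p t + (- + 1) * evalP q t         ≡⟨ cong (_+_ (evalP p t)) (ℤP.-1*i≡-i (evalP q t)) ⟩
    evalP p t - evalP q t                   ∎

  odd : ℕ → ℤ
  odd k = + suc (k ℕ.+ k)

  -- If a + m·e = 0 and |a| < m, then e = 0: a nonzero multiple of m is too large.
  small-remainder : ∀ (a e : ℤ) (m : ℕ) → ∣ a ∣ < m → a + + m * e ≡ + 0 → e ≡ + 0
  small-remainder a e m ∣a∣<m a+me≡0 = ℤP.∣i∣≡0⇒i≡0 (∣e∣≡0 ∣ e ∣ refl)
    where
    a≡-me : a ≡ - (+ m * e)
    a≡-me = begin
      a                       ≡⟨ cancel a (+ m * e) ⟩
      (a + + m * e) - + m * e ≡⟨ cong (_- + m * e) a+me≡0 ⟩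
      + 0 - + m * e           ≡⟨ ℤP.+-identityˡ _ ⟩
      - (+ m * e)             ∎
      where
      cancel : ∀ x y → x ≡ (x + y) - y
      cancel = solve-∀
    ∣a∣≡m∣e∣ : ∣ a ∣ ≡ m ℕ.* ∣ e ∣
    ∣a∣≡m∣e∣ = begin
      ∣ a ∣           ≡⟨ cong ∣_∣ a≡-me ⟩
      ∣ - (+ m * e) ∣ ≡⟨ ℤP.∣-i∣≡∣i∣ (+ m * e) ⟩
      ∣ + m * e ∣     ≡⟨ ℤP.abs-* (+ m) e ⟩
      m ℕ.* ∣ e ∣     ∎
    ∣e∣≡0 : ∀ r → ∣ e ∣ ≡ r → ∣ e ∣ ≡ 0
    ∣e∣≡0 zero    ∣e∣≡r = ∣e∣≡r
    ∣e∣≡0 (suc r) ∣e∣≡r = ⊥-elim (ℕP.<⇒≱ ∣a∣<m (ℕP.≤-trans (ℕP.m≤m*n m (suc r))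
                              (ℕP.≤-reflexive (sym (trans ∣a∣≡m∣e∣ (cong (m ℕ.*_) ∣e∣≡r))))))

  -- The constant term a is a multiple of 2k+1 for every k, hence 0 (take k = |a|+1);
  -- then p(2k+1) = 0 for the tail p, and induction applies.
  vanishing-at-odd⇒zero : ∀ p → (∀ k → 1 ≤ k → evalP p (odd k) ≡ + 0) → ∀ t → evalP p t ≡ + 0
  vanishing-at-odd⇒zero []      _      t = refl
  vanishing-at-odd⇒zero (a ∷ p) vanish t = begin
    a + t * evalP p t   ≡⟨ cong₂ (λ x y → x + t * y) a≡0 (vanishing-at-odd⇒zero p tail-vanishes t) ⟩
    + 0 + t * + 0       ≡⟨ cong (_+_ (+ 0)) (ℤP.*-zeroʳ t) ⟩
    + 0                 ∎
    where
    a≡0 : a ≡ + 0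
    a≡0 = begin
      a                      ≡⟨ sym (ℤP.+-identityʳ a) ⟩
      a + + 0                ≡⟨ cong (_+_ a) (sym (ℤP.*-zeroʳ (odd k))) ⟩
      a + odd k * + 0        ≡⟨ cong (λ x → a + odd k * x) (sym tail≡0) ⟩
      a + odd k * evalP p (odd k) ≡⟨ vanish k (s≤s z≤n) ⟩
      + 0                    ∎
      where
      k = suc ∣ a ∣
      tail≡0 : evalP p (odd k) ≡ + 0
      tail≡0 = small-remainder a _ (suc (k ℕ.+ k))
                 (s≤s (ℕP.≤-trans (ℕP.n≤1+n ∣ a ∣) (ℕP.m≤m+n k k))) (vanish k (s≤s z≤n))
    tail-vanishes : ∀ k → 1 ≤ k → evalP p (odd k) ≡ + 0
    tail-vanishes k 1≤k with ℤP.i*j≡0⇒i≡0∨j≡0 (odd k) {evalP p (odd k)}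
                               (trans (sym (ℤP.+-identityˡ _))
                                 (trans (cong (λ x → x + odd k * evalP p (odd k)) (sym a≡0)) (vanish k 1≤k)))
    ... | inj₁ ()
    ... | inj₂ p≡0 = p≡0

  agreeing-at-odd⇒equal : ∀ p q → (∀ k → 1 ≤ k → evalP p (odd k) ≡ evalP q (odd k)) →
                          ∀ t → evalP p t ≡ evalP q t
  agreeing-at-odd⇒equal p q agree t =
    ℤP.i-j≡0⇒i≡j _ _ (trans (sym (eval-subP p q t)) (vanishing-at-odd⇒zero (subP p q) difference-vanishes t))
    where
    difference-vanishes : ∀ k → 1 ≤ k → evalP (subP p q) (odd k) ≡ + 0
    difference-vanishes k 1≤k = trans (eval-subP p q (odd k)) (ℤP.i≡j⇒i-j≡0 (agree k 1≤k))

  products-agreeing-at-odd⇒equal : ∀ p q r s →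
    (∀ k → 1 ≤ k → evalP p (odd k) * evalP q (odd k) ≡ evalP r (odd k) * evalP s (odd k)) →
    ∀ t → evalP p t * evalP q t ≡ evalP r t * evalP s t
  products-agreeing-at-odd⇒equal p q r s agree t = begin
    evalP p t * evalP q t  ≡⟨ eval-mulP p q t ⟨
    evalP (mulP p q) t     ≡⟨ agreeing-at-odd⇒equal (mulP p q) (mulP r s) agree-mulP t ⟩
    evalP (mulP r s) t     ≡⟨ eval-mulP r s t ⟩
    evalP r t * evalP s t  ∎
    where
    agree-mulP : ∀ k → 1 ≤ k → evalP (mulP p q) (odd k) ≡ evalP (mulP r s) (odd k)
    agree-mulP k 1≤k = trans (eval-mulP p q (odd k)) (trans (agree k 1≤k) (sym (eval-mulP r s (odd k))))

-- Functions are
-- compared pointwise (by the Boolean test _≐_), so the basic fact is that every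
-- function is enumerated exactly once up to pointwise equality; from it follow the
-- sifting property and invariance under post-composition with an involution.
module FunctionSums (M : ℕ) where
  open Sums
  open Booleans
  open import Data.Bool using (Bool; true; false; _∧_)
  open import Data.Nat as ℕ using (ℕ; zero; suc)
  import Data.Nat.Properties as ℕP
  open import Data.Fin as Fin using (Fin)
  import Data.Fin.Properties as FP
  open import Data.List using (map; allFin)
  import Data.Vec.Functional as VF
  open import Relation.Binary.PropositionalEquality
  open import Function using (_∘_)
  open ≡-Reasoning

  Fn : ℕ → Set
  Fn m = Fin m → Fin M

  Σf : ∀ m → (Fn m → ℕ) → ℕ
  Σf m F = S (allFuns m M) F

  infix 4 _≐_
  _≐_ : ∀ {m} → Fn m → Fn m → Bool
  _≐_ {m} γ δ = allᵇ (λ i → γ i == δ i) (allFin m)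

  ==-sound : ∀ {m} {a b : Fin m} → (a == b) ≡ true → a ≡ b
  ==-sound {a = a} {b} = ⌊⌋-sound (a FP.≟ b)

  ==-complete : ∀ {m} {a b : Fin m} → a ≡ b → (a == b) ≡ true
  ==-complete {a = a} {b} = ⌊⌋-true (a FP.≟ b)

  ≐-sound : ∀ {m} (γ δ : Fn m) → (γ ≐ δ) ≡ true → γ ≗ δ
  ≐-sound γ δ γ≐δ i = ==-sound (allᵇ-sound (λ i → γ i == δ i) γ≐δ i)

  ≐-complete : ∀ {m} (γ δ : Fn m) → γ ≗ δ → (γ ≐ δ) ≡ true
  ≐-complete γ δ γ≗δ = allᵇ-complete (λ i → γ i == δ i) (λ i → ==-complete (γ≗δ i))

  ≐-resp : ∀ {m} {γ γ′ δ δ′ : Fn m} → γ ≗ γ′ → δ ≗ δ′ → (γ ≐ δ) ≡ (γ′ ≐ δ′)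
  ≐-resp {γ = γ} {γ′} {δ} {δ′} γ≗γ′ δ≗δ′ = bool-ext
    (λ γ≐δ → ≐-complete γ′ δ′ (λ i → trans (sym (γ≗γ′ i)) (trans (≐-sound γ δ γ≐δ i) (δ≗δ′ i))))
    (λ γ′≐δ′ → ≐-complete γ δ (λ i → trans (γ≗γ′ i) (trans (≐-sound γ′ δ′ γ′≐δ′ i) (sym (δ≗δ′ i)))))

  Extensional : ∀ {m} → (Fn m → ℕ) → Set
  Extensional {m} F = ∀ γ δ → γ ≗ δ → F γ ≡ F δ

  count-equal : ∀ {n} (x : Fin n) → S (allFin n) (λ c → ind (c == x)) ≡ 1
  count-equal {suc n} x = trans (S-allFin-suc (λ c → ind (c == x))) (split x)
    where
    split : ∀ x → ind (Fin.zero == x) ℕ.+ S (allFin n) (λ c → ind (Fin.suc c == x)) ≡ 1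
    split Fin.zero = cong suc (trans (S-cong (allFin n) (λ c → cong ind (⌊⌋-false (Fin.suc c FP.≟ Fin.zero) λ ())))
                                     (S-0 (allFin n)))
    split (Fin.suc x) = begin
      ind (Fin.zero == Fin.suc x) ℕ.+ S (allFin n) (λ c → ind (Fin.suc c == Fin.suc x))
        ≡⟨ cong₂ ℕ._+_ (cong ind (⌊⌋-false (Fin.zero FP.≟ Fin.suc x) λ ()))
                       (S-cong (allFin n) (λ c → cong ind (suc-== c x))) ⟩
      S (allFin n) (λ c → ind (c == x))
        ≡⟨ count-equal x ⟩
      1 ∎
      where
      suc-== : ∀ c x → (Fin.suc c == Fin.suc x) ≡ (c == x)
      suc-== c x = bool-ext (λ e → ==-complete (FP.suc-injective (==-sound e)))
                            (λ e → ==-complete (cong Fin.suc (==-sound e)))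

  enumerated-once : ∀ m (g : Fn m) → Σf m (λ δ → ind (δ ≐ g)) ≡ 1
  enumerated-once zero    g = refl
  enumerated-once (suc m) g = begin
    Σf (suc m) (λ δ → ind (δ ≐ g))
      ≡⟨ S-concatMap _ (allFin M) _ ⟩
    S (allFin M) (λ c → S (map (c VF.∷_) (allFuns m M)) (λ δ → ind (δ ≐ g)))
      ≡⟨ S-cong (allFin M) (λ c → S-map _ (allFuns m M) _) ⟩
    S (allFin M) (λ c → Σf m (λ δ → ind ((c VF.∷ δ) ≐ g)))
      ≡⟨ S-cong (allFin M) (λ c → S-cong (allFuns m M) (λ δ → trans (cong ind (cons-≐ c δ)) (ind-∧ (c == g₀) _))) ⟩
    S (allFin M) (λ c → Σf m (λ δ → ind (c == g₀) ℕ.* ind (δ ≐ g ∘ Fin.suc)))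
      ≡⟨ S-cong (allFin M) (λ c → S-*ˡ (allFuns m M) (ind (c == g₀)) _) ⟩
    S (allFin M) (λ c → ind (c == g₀) ℕ.* Σf m (λ δ → ind (δ ≐ g ∘ Fin.suc)))
      ≡⟨ S-cong (allFin M) (λ c → cong (ind (c == g₀) ℕ.*_) (enumerated-once m (g ∘ Fin.suc))) ⟩
    S (allFin M) (λ c → ind (c == g₀) ℕ.* 1)
      ≡⟨ S-cong (allFin M) (λ c → ℕP.*-identityʳ _) ⟩
    S (allFin M) (λ c → ind (c == g₀))
      ≡⟨ count-equal g₀ ⟩
    1 ∎
    where
    g₀ = g Fin.zero
    cons-≐ : ∀ c δ → ((c VF.∷ δ) ≐ g) ≡ ((c == g₀) ∧ (δ ≐ g ∘ Fin.suc))
    cons-≐ c δ = bool-ext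
      (λ e → ∧-intro (==-complete (≐-sound (c VF.∷ δ) g e Fin.zero))
                     (≐-complete δ (g ∘ Fin.suc) (≐-sound (c VF.∷ δ) g e ∘ Fin.suc)))
      (λ e → ≐-complete (c VF.∷ δ) g λ
        { Fin.zero → ==-sound (∧-left e)
        ; (Fin.suc i) → ≐-sound δ (g ∘ Fin.suc) (∧-right {c == g₀} e) i })

  insert-unique : ∀ m (g : Fn m) x → x ≡ Σf m (λ δ → ind (δ ≐ g) ℕ.* x)
  insert-unique m g x = begin
    x                                   ≡⟨ ℕP.*-identityˡ x ⟨
    1 ℕ.* x                             ≡⟨ cong (ℕ._* x) (enumerated-once m g) ⟨
    Σf m (λ δ → ind (δ ≐ g)) ℕ.* x      ≡⟨ S-*ʳ (allFuns m M) x _ ⟨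
    Σf m (λ δ → ind (δ ≐ g) ℕ.* x)      ∎

  sift : ∀ m (g : Fn m) (F : Fn m → ℕ) → Extensional F → Σf m (λ δ → ind (δ ≐ g) ℕ.* F δ) ≡ F g
  sift m g F F-ext = trans (S-cong (allFuns m M) at-g) (sym (insert-unique m g (F g)))
    where
    at-g : ∀ δ → ind (δ ≐ g) ℕ.* F δ ≡ ind (δ ≐ g) ℕ.* F g
    at-g δ with δ ≐ g in δ≐g
    ... | true  = cong (1 ℕ.*_) (F-ext δ g (≐-sound δ g δ≐g))
    ... | false = refl

  reindex-involution : ∀ m (φ : Fin M → Fin M) → (∀ x → φ (φ x) ≡ x) → (F : Fn m → ℕ) → Extensional F →
                       Σf m F ≡ Σf m (λ γ → F (φ ∘ γ))
  reindex-involution m φ φφ≡id F F-ext = sym (begin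
    Σf m (λ γ → F (φ ∘ γ))
      ≡⟨ S-cong (allFuns m M) (λ γ → sym (sift m (φ ∘ γ) F F-ext)) ⟩
    Σf m (λ γ → Σf m (λ δ → ind (δ ≐ φ ∘ γ) ℕ.* F δ))
      ≡⟨ S-swap (allFuns m M) (allFuns m M) _ ⟩
    Σf m (λ δ → Σf m (λ γ → ind (δ ≐ φ ∘ γ) ℕ.* F δ))
      ≡⟨ S-cong (allFuns m M) (λ δ → S-*ʳ (allFuns m M) (F δ) _) ⟩
    Σf m (λ δ → Σf m (λ γ → ind (δ ≐ φ ∘ γ)) ℕ.* F δ)
      ≡⟨ S-cong (allFuns m M) (λ δ → cong (ℕ._* F δ)
           (trans (S-cong (allFuns m M) (λ γ → cong ind (transpose δ γ))) (enumerated-once m (φ ∘ δ)))) ⟩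
    Σf m (λ δ → 1 ℕ.* F δ)
      ≡⟨ S-cong (allFuns m M) (λ δ → ℕP.*-identityˡ (F δ)) ⟩
    Σf m F ∎)
    where
    transpose : ∀ δ γ → (δ ≐ φ ∘ γ) ≡ (γ ≐ φ ∘ δ)
    transpose δ γ = bool-ext
      (λ e → ≐-complete γ (φ ∘ δ) (λ i → trans (sym (φφ≡id (γ i))) (cong φ (sym (≐-sound δ (φ ∘ γ) e i)))))
      (λ e → ≐-complete δ (φ ∘ γ) (λ i → trans (sym (φφ≡id (δ i))) (cong φ (sym (≐-sound γ (φ ∘ δ) e i)))))

module Colourings (k : ℕ) where
  open Booleans
  open import Data.Bool using (true; _∨_; not)
  open import Data.Nat as ℕ using (suc; _≤_; s≤s)
  import Data.Nat.Properties as ℕP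
  open import Data.Integer as ℤ using (+_; -_)
  import Data.Integer.Properties as ℤP
  open import Data.Integer.Tactic.RingSolver using (solve-∀)
  open import Data.Fin as Fin using (Fin; toℕ; opposite; fromℕ<)
  import Data.Fin.Properties as FP
  open import Data.List using (allFin)
  open import Data.Product using (_×_; _,_)
  open import Data.Sum using (inj₁; inj₂)
  open import Relation.Binary.PropositionalEquality
  open import Function using (_∘_)

  M : ℕ
  M = suc (k ℕ.+ k)

  open FunctionSums M public

  Col : Set
  Col = Λ k

  opp : Col → Col
  opp = opposite

  opp-involutive : ∀ c → opp (opp c) ≡ c
  opp-involutive = FP.opposite-involutive

  zero-colour : Col
  zero-colour = fromℕ< (s≤s (ℕP.m≤m+n k k))

  val-zero : val k zero-colour ≡ + 0
  val-zero = trans (cong (λ t → + t ℤ.- + k) (FP.toℕ-fromℕ< (s≤s (ℕP.m≤m+n k k)))) (ℤP.+-inverseʳ (+ k))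

  val-opp : ∀ c → val k (opp c) ≡ - val k c
  val-opp c = begin
    + toℕ (opp c) ℤ.- + k                  ≡⟨ cong (λ t → + t ℤ.- + k) (FP.opposite-prop c) ⟩
    + ((k ℕ.+ k) ℕ.∸ toℕ c) ℤ.- + k         ≡⟨ cong (ℤ._- + k) (trans (sym (ℤP.⊖-≥ c≤2k))
                                                 (sym (ℤP.[+m]-[+n]≡m⊖n (k ℕ.+ k) (toℕ c)))) ⟩
    (+ (k ℕ.+ k) ℤ.- + toℕ c) ℤ.- + k      ≡⟨ cong (λ z → (z ℤ.- + toℕ c) ℤ.- + k) (ℤP.pos-+ k k) ⟩
    (+ k ℤ.+ + k ℤ.- + toℕ c) ℤ.- + k      ≡⟨ negate (+ k) (+ toℕ c) ⟩
    - (+ toℕ c ℤ.- + k)                    ∎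
    where
    open ≡-Reasoning
    c≤2k : toℕ c ≤ k ℕ.+ k
    c≤2k = ℕP.≤-pred (FP.toℕ<n c)
    negate : ∀ a b → (a ℤ.+ a ℤ.- b) ℤ.- a ≡ - (b ℤ.- a)
    negate = solve-∀

  val-injective : ∀ {c d} → val k c ≡ val k d → c ≡ d
  val-injective {c} {d} e = FP.toℕ-injective (ℤP.+-injective
    (trans (shift (+ toℕ c) (+ k)) (trans (cong (ℤ._+ + k) e) (sym (shift (+ toℕ d) (+ k))))))
    where
    shift : ∀ x y → x ≡ (x ℤ.- y) ℤ.+ y
    shift = solve-∀

  opp-zero : opp zero-colour ≡ zero-colour
  opp-zero = val-injective (trans (val-opp zero-colour) (trans (cong -_ val-zero) (sym val-zero)))

  self-opposite⇒zero : ∀ c → c ≡ opp c → c ≡ zero-colour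
  self-opposite⇒zero c c≡-c with ℤP.i*j≡0⇒i≡0∨j≡0 (val k c) {+ 2} twice≡0
    where
    twice≡0 : val k c ℤ.* + 2 ≡ + 0
    twice≡0 = begin
      val k c ℤ.* + 2                 ≡⟨ double (val k c) ⟩
      val k c ℤ.+ val k c             ≡⟨ cong (ℤ._+_ (val k c)) (trans (cong (val k) c≡-c) (val-opp c)) ⟩
      val k c ℤ.+ - val k c           ≡⟨ ℤP.+-inverseʳ (val k c) ⟩
      + 0                             ∎
      where
      open ≡-Reasoning
      double : ∀ x → x ℤ.* + 2 ≡ x ℤ.+ x
      double = solve-∀
  ... | inj₁ val≡0 = val-injective (trans val≡0 (sym val-zero))
  ... | inj₂ ()

  Proper : ∀ {N} → SGraph N → Fn N → Set
  Proper {N} G γ = (∀ u v → posE G u v ≡ true → γ u ≢ γ v)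
                 × (∀ u v → negE G u v ≡ true → γ u ≢ opp (γ v))
                 × (∀ u → loop G u ≡ true → γ u ≢ zero-colour)

  proper-sound : ∀ {N} (G : SGraph N) γ → isProper G k γ ≡ true → Proper G γ
  proper-sound {N} G γ proper = pos , neg , loops
    where
    row : ∀ u → _
    row u = allᵇ-sound _ proper u
    cell : ∀ u v → _
    cell u v = allᵇ-sound _ (∧-left (row u)) v
    pos : ∀ u v → posE G u v ≡ true → γ u ≢ γ v
    pos u v e γu≡γv = nand-elim (∧-left (cell u v)) e (⌊⌋-true (_ ℤP.≟ _) (cong (val k) γu≡γv))
    neg : ∀ u v → negE G u v ≡ true → γ u ≢ opp (γ v)
    neg u v e γu≡-γv = nand-elim (∧-right {not (posE G u v) ∨ _} (cell u v)) e
                         (⌊⌋-true (_ ℤP.≟ _) (trans (cong (val k) γu≡-γv) (val-opp (γ v))))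
    loops : ∀ u → loop G u ≡ true → γ u ≢ zero-colour
    loops u e γu≡0 = nand-elim (∧-right {allᵇ _ (allFin N)} (row u)) e
                       (⌊⌋-true (_ ℤP.≟ _) (trans (cong (val k) γu≡0) val-zero))

  proper-complete : ∀ {N} (G : SGraph N) γ → Proper G γ → isProper G k γ ≡ true
  proper-complete {N} G γ (pos , neg , loops) = allᵇ-complete _ λ u → ∧-intro
    (allᵇ-complete _ λ v → ∧-intro
      (nand-intro λ e val≡ → pos u v e (val-injective (⌊⌋-sound (_ ℤP.≟ _) val≡)))
      (nand-intro λ e val≡ → neg u v e (val-injective (trans (⌊⌋-sound (_ ℤP.≟ _) val≡) (sym (val-opp (γ v)))))))
    (nand-intro λ e val≡ → loops u e (val-injective (trans (⌊⌋-sound (_ ℤP.≟ _) val≡) (sym val-zero))))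

  proper-resp : ∀ {N} (G : SGraph N) {γ δ} → γ ≗ δ → Proper G γ → Proper G δ
  proper-resp G γ≗δ (pos , neg , loops) =
      (λ u v e δu≡δv → pos u v e (trans (γ≗δ u) (trans δu≡δv (sym (γ≗δ v)))))
    , (λ u v e δu≡-δv → neg u v e (trans (γ≗δ u) (trans δu≡-δv (cong opp (sym (γ≗δ v))))))
    , (λ u e δu≡0 → loops u e (trans (γ≗δ u) δu≡0))

  isProper-resp : ∀ {N} (G : SGraph N) {γ δ} → γ ≗ δ → isProper G k γ ≡ isProper G k δ
  isProper-resp G γ≗δ = bool-ext
    (λ p → proper-complete G _ (proper-resp G γ≗δ (proper-sound G _ p)))
    (λ p → proper-complete G _ (proper-resp G (sym ∘ γ≗δ) (proper-sound G _ p)))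

  record SignedHom {a b} (H : SGraph a) (G : SGraph b) (e : Fin a → Fin b) : Set where
    field
      pos  : ∀ x y → posE H x y ≡ true → posE G (e x) (e y) ≡ true
      neg  : ∀ x y → negE H x y ≡ true → negE G (e x) (e y) ≡ true
      loop : ∀ x → loop H x ≡ true → loop G (e x) ≡ true

  induced⇒hom : ∀ {a b} {H : SGraph a} {G : SGraph b} {e} → IsInducedEmb H G e → SignedHom H G e
  induced⇒hom (_ , pos≡ , neg≡ , loop≡) = record
    { pos  = λ x y p → trans (sym (pos≡ x y)) p
    ; neg  = λ x y n → trans (sym (neg≡ x y)) n
    ; loop = λ x l → trans (sym (loop≡ x)) l }

  restrict : ∀ {a b} {H : SGraph a} {G : SGraph b} {e} → SignedHom H G e → ∀ γ → Proper G γ → Proper H (γ ∘ e)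
  restrict {e = e} hom γ (pos , neg , loops) =
      (λ x y p → pos (e x) (e y) (SignedHom.pos hom x y p))
    , (λ x y n → neg (e x) (e y) (SignedHom.neg hom x y n))
    , (λ x l → loops (e x) (SignedHom.loop hom x l))

-- They preserve properness,
-- and any two proper colourings of B_n are related by a chain of them; hence every
-- symmetry-invariant quantity is constant on the proper colourings of B_n.
module Symmetries (k : ℕ) where
  open Colourings k
  open Booleans using (bool-ext; ⌊⌋-false)
  open import Data.Bool using (true; not)
  open import Data.Nat as ℕ using (zero; suc; _<_; s≤s; z≤n)
  import Data.Nat.Properties as ℕP
  open import Data.Fin as Fin using (Fin; toℕ; fromℕ<)
  import Data.Fin.Properties as FP
  open import Data.Product using (Σ; _×_; _,_; proj₁; proj₂)
  open import Data.Empty using (⊥-elim)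
  open import Relation.Nullary using (yes; no)
  open import Relation.Binary.PropositionalEquality
  open import Function using (_∘_; id)

  record Symmetry : Set where
    field
      φ           : Col → Col
      involutive  : ∀ c → φ (φ c) ≡ c
      commutes    : ∀ c → φ (opp c) ≡ opp (φ c)

    injective : ∀ {c d} → φ c ≡ φ d → c ≡ d
    injective {c} {d} e = trans (sym (involutive c)) (trans (cong φ e) (involutive d))

    -- φ 0 = φ (−0) = −φ 0, so φ 0 = 0
    fixes-zero : φ zero-colour ≡ zero-colour
    fixes-zero = self-opposite⇒zero _ (trans (cong φ (sym opp-zero)) (commutes zero-colour))

    -- φ respects equality, negation and 0, so it maps proper colourings to proper ones
    preserves-proper : ∀ {N} (G : SGraph N) γ → Proper G γ → Proper G (φ ∘ γ)
    preserves-proper G γ (pos , neg , loops) =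
        (λ u v e φγu≡φγv → pos u v e (injective φγu≡φγv))
      , (λ u v e φγu≡-φγv → neg u v e (injective (trans φγu≡-φγv (sym (commutes (γ v))))))
      , (λ u e φγu≡0 → loops u e (injective (trans φγu≡0 (sym fixes-zero))))

    isProper-invariant : ∀ {N} (G : SGraph N) γ → isProper G k (φ ∘ γ) ≡ isProper G k γ
    isProper-invariant G γ = bool-ext
      (λ p → proper-complete G γ (proper-resp G (involutive ∘ γ)
                (preserves-proper G (φ ∘ γ) (proper-sound G (φ ∘ γ) p))))
      (λ p → proper-complete G (φ ∘ γ) (preserves-proper G γ (proper-sound G γ p)))

  swap : Col → Col → Col → Col
  swap p q x with x FP.≟ p
  ... | yes _ = q
  ... | no _ with x FP.≟ q
  ...   | yes _ = p
  ...   | no _  = x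

  swap-p : ∀ p q → swap p q p ≡ q
  swap-p p q with p FP.≟ p
  ... | yes _ = refl
  ... | no p≢p = ⊥-elim (p≢p refl)

  swap-q : ∀ p q → swap p q q ≡ p
  swap-q p q with q FP.≟ p
  ... | yes q≡p = q≡p
  ... | no _ with q FP.≟ q
  ...   | yes _ = refl
  ...   | no q≢q = ⊥-elim (q≢q refl)

  swap-other : ∀ p q x → x ≢ p → x ≢ q → swap p q x ≡ x
  swap-other p q x x≢p x≢q with x FP.≟ p
  ... | yes x≡p = ⊥-elim (x≢p x≡p)
  ... | no _ with x FP.≟ q
  ...   | yes x≡q = ⊥-elim (x≢q x≡q)
  ...   | no _    = refl

  swap-cases : ∀ (P : Col → Set) p q x → P p → P q → (x ≢ p → x ≢ q → P x) → P x
  swap-cases P p q x Pp Pq Pother with x FP.≟ p | x FP.≟ q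
  ... | yes refl | _        = Pp
  ... | no _     | yes refl = Pq
  ... | no x≢p   | no x≢q   = Pother x≢p x≢q

  swap-involutive : ∀ p q x → swap p q (swap p q x) ≡ x
  swap-involutive p q x = swap-cases (λ z → swap p q (swap p q z) ≡ z) p q x
    (trans (cong (swap p q) (swap-p p q)) (swap-q p q))
    (trans (cong (swap p q) (swap-q p q)) (swap-p p q))
    (λ x≢p x≢q → trans (cong (swap p q) (swap-other p q x x≢p x≢q)) (swap-other p q x x≢p x≢q))

  swap-comm : ∀ p q x → swap p q x ≡ swap q p x
  swap-comm p q x = swap-cases (λ z → swap p q z ≡ swap q p z) p q x
    (trans (swap-p p q) (sym (swap-q q p)))
    (trans (swap-q p q) (sym (swap-p q p)))
    (λ x≢p x≢q → trans (swap-other p q x x≢p x≢q) (sym (swap-other q p x x≢q x≢p)))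

  swap-opp : ∀ p q x → swap p q (opp x) ≡ opp (swap (opp p) (opp q) x)
  swap-opp p q x = swap-cases (λ z → swap p q (opp z) ≡ opp (swap (opp p) (opp q) z)) (opp p) (opp q) x
    (trans (cong (swap p q) (opp-involutive p))
      (trans (swap-p p q) (trans (sym (opp-involutive q)) (cong opp (sym (swap-p (opp p) (opp q)))))))
    (trans (cong (swap p q) (opp-involutive q))
      (trans (swap-q p q) (trans (sym (opp-involutive p)) (cong opp (sym (swap-q (opp p) (opp q)))))))
    (λ x≢-p x≢-q → trans (swap-other p q (opp x) (x≢-p ∘ opp-cancel) (x≢-q ∘ opp-cancel))
                         (cong opp (sym (swap-other (opp p) (opp q) x x≢-p x≢-q))))
    where
    opp-cancel : ∀ {c} → opp x ≡ c → x ≡ opp c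
    opp-cancel {c} -x≡c = trans (sym (opp-involutive x)) (cong opp -x≡c)

  swap-disjoint : ∀ p q r s → p ≢ r → p ≢ s → q ≢ r → q ≢ s →
                  ∀ x → swap p q (swap r s x) ≡ swap r s (swap p q x)
  swap-disjoint p q r s p≢r p≢s q≢r q≢s x =
    swap-cases Commute p q x
      (trans (cong (swap p q) (swap-other r s p p≢r p≢s))
        (trans (swap-p p q) (trans (sym (swap-other r s q q≢r q≢s)) (cong (swap r s) (sym (swap-p p q))))))
      (trans (cong (swap p q) (swap-other r s q q≢r q≢s))
        (trans (swap-q p q) (trans (sym (swap-other r s p p≢r p≢s)) (cong (swap r s) (sym (swap-q p q))))))
      λ x≢p x≢q → swap-cases Commute r s x
        (trans (cong (swap p q) (swap-p r s))
          (trans (swap-other p q s (p≢s ∘ sym) (q≢s ∘ sym))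
            (trans (sym (swap-p r s)) (cong (swap r s) (sym (swap-other p q r (p≢r ∘ sym) (q≢r ∘ sym)))))))
        (trans (cong (swap p q) (swap-q r s))
          (trans (swap-other p q r (p≢r ∘ sym) (q≢r ∘ sym))
            (trans (sym (swap-q r s)) (cong (swap r s) (sym (swap-other p q s (p≢s ∘ sym) (q≢s ∘ sym)))))))
        λ x≢r x≢s → trans (cong (swap p q) (swap-other r s x x≢r x≢s))
          (trans (swap-other p q x x≢p x≢q)
            (trans (sym (swap-other r s x x≢r x≢s)) (cong (swap r s) (sym (swap-other p q x x≢p x≢q)))))
    where
    Commute : Col → Set
    Commute z = swap p q (swap r s z) ≡ swap r s (swap p q z)

  nonzero⇒not-self-opposite : ∀ {a} → a ≢ zero-colour → a ≢ opp a
  nonzero⇒not-self-opposite a≢0 a≡-a = a≢0 (self-opposite⇒zero _ a≡-a)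

  -- For nonzero colours a, b there is a symmetry sending a to b and fixing every
  -- colour outside {±a, ±b}: the identity, the swap of a and −a, or the product of
  -- the disjoint swaps (a b) and (−a −b).
  symmetry-sending : ∀ a b → a ≢ zero-colour → b ≢ zero-colour →
    Σ Symmetry λ S → Symmetry.φ S a ≡ b ×
      (∀ x → x ≢ a → x ≢ opp a → x ≢ b → x ≢ opp b → Symmetry.φ S x ≡ x)
  symmetry-sending a b a≢0 b≢0 with a FP.≟ b | b FP.≟ opp a
  ... | yes refl | _ = record { φ = id ; involutive = λ _ → refl ; commutes = λ _ → refl }
                     , refl , (λ _ _ _ _ _ → refl)
  ... | no _ | yes refl =
        record { φ = swap a (opp a) ; involutive = swap-involutive a (opp a) ; commutes = commutes }
        , swap-p a (opp a) , (λ x x≢a x≢-a _ _ → swap-other a (opp a) x x≢a x≢-a)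
    where
    commutes : ∀ x → swap a (opp a) (opp x) ≡ opp (swap a (opp a) x)
    commutes x = trans (swap-opp a (opp a) x)
                   (cong opp (trans (cong (λ z → swap (opp a) z x) (opp-involutive a)) (swap-comm (opp a) a x)))
  ... | no a≢b | no b≢-a = S , φa≡b , fixes
    where
    a≢-b : a ≢ opp b
    a≢-b a≡-b = b≢-a (trans (sym (opp-involutive b)) (cong opp (sym a≡-b)))
    φ : Col → Col
    φ x = swap a b (swap (opp a) (opp b) x)
    disjoint : ∀ x → swap a b (swap (opp a) (opp b) x) ≡ swap (opp a) (opp b) (swap a b x)
    disjoint = swap-disjoint a b (opp a) (opp b)
                 (nonzero⇒not-self-opposite a≢0) a≢-b b≢-a (nonzero⇒not-self-opposite b≢0)
    S : Symmetry
    S = record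
      { φ = φ
      ; involutive = λ x → trans (cong (swap a b) (sym (disjoint (swap (opp a) (opp b) x))))
                               (trans (swap-involutive a b _) (swap-involutive (opp a) (opp b) x))
      ; commutes = λ x → trans (cong (swap a b) (swap-opp (opp a) (opp b) x))
                             (trans (cong (λ z → swap a b (opp z))
                                      (cong₂ (λ u v → swap u v x) (opp-involutive a) (opp-involutive b)))
                             (trans (swap-opp a b (swap a b x)) (cong opp (sym (disjoint x)))))
      }
    φa≡b : φ a ≡ b
    φa≡b = trans (cong (swap a b) (swap-other (opp a) (opp b) a (nonzero⇒not-self-opposite a≢0) a≢-b))
                 (swap-p a b)
    fixes : ∀ x → x ≢ a → x ≢ opp a → x ≢ b → x ≢ opp b → φ x ≡ x
    fixes x x≢a x≢-a x≢b x≢-b =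
      trans (cong (swap a b) (swap-other (opp a) (opp b) x x≢-a x≢-b)) (swap-other a b x x≢a x≢b)

  module _ {n} (β : Fn n) (proper : Proper (B n) β) where
    distinct-in-B : ∀ i j → i ≢ j → posE (B n) i j ≡ true
    distinct-in-B i j i≢j = cong not (⌊⌋-false (i FP.≟ j) i≢j)

    B-injective : ∀ i j → i ≢ j → β i ≢ β j
    B-injective i j i≢j = proj₁ proper i j (distinct-in-B i j i≢j)

    B-non-opposite : ∀ i j → i ≢ j → β i ≢ opp (β j)
    B-non-opposite i j i≢j = proj₁ (proj₂ proper) i j (distinct-in-B i j i≢j)

    B-nonzero : ∀ i → β i ≢ zero-colour
    B-nonzero i = proj₂ (proj₂ proper) i refl

  Invariant : ∀ {n} → (Fn n → ℕ) → Set
  Invariant E = ∀ (S : Symmetry) β → E (Symmetry.φ S ∘ β) ≡ E β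

  -- An extensional, symmetry-invariant quantity is constant on proper colourings of
  -- B_n: if β agrees with β′ below vertex i, a symmetry sending β i to β′ i fixes the
  -- colours β j (j < i), as these avoid ±β i and ±β′ i; so φ ∘ β agrees with β′ below i+1.
  invariant⇒constant : ∀ {n} (E : Fn n → ℕ) → Extensional E → Invariant E →
                       ∀ β β′ → Proper (B n) β → Proper (B n) β′ → E β ≡ E β′
  invariant⇒constant {n} E E-ext E-inv β₀ β′ proper₀ proper′ = agree-below n 0 refl β₀ proper₀ (λ _ ())
    where
    agree-below : ∀ r i → i ℕ.+ r ≡ n → ∀ β → Proper (B n) β → (∀ j → toℕ j < i → β j ≡ β′ j) → E β ≡ E β′
    agree-below zero    i i+0≡n β proper agree =
      E-ext β β′ λ j → agree j (subst (toℕ j <_) (trans (sym i+0≡n) (ℕP.+-identityʳ i)) (FP.toℕ<n j))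
    agree-below (suc r) i i+r+1≡n β proper agree =
      trans (sym (E-inv S β)) (agree-below r (suc i) (trans (sym (ℕP.+-suc i r)) i+r+1≡n) (φ ∘ β)
               (Symmetry.preserves-proper S (B n) β proper) agree′)
      where
      i<n : i < n
      i<n = subst (i <_) i+r+1≡n (ℕP.m<m+n i (s≤s z≤n))
      v : Fin n
      v = fromℕ< i<n
      sending = symmetry-sending (β v) (β′ v) (B-nonzero β proper v) (B-nonzero β′ proper′ v)
      S = proj₁ sending
      φ = Symmetry.φ S
      agree′ : ∀ j → toℕ j < suc i → φ (β j) ≡ β′ j
      agree′ j j<i+1 with toℕ j ℕ.≟ i
      ... | yes j≡i = subst (λ w → φ (β w) ≡ β′ w) (sym (FP.toℕ-injective (trans j≡i (sym (FP.toℕ-fromℕ< i<n)))))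
                        (proj₁ (proj₂ sending))
      ... | no j≢i = trans (proj₂ (proj₂ sending) (β j)
                             (B-injective β proper j v j≢v) (B-non-opposite β proper j v j≢v)
                             (λ e → B-injective β′ proper′ j v j≢v (trans (sym βj≡β′j) e))
                             (λ e → B-non-opposite β′ proper′ j v j≢v (trans (sym βj≡β′j) e)))
                           βj≡β′j
        where
        βj≡β′j : β j ≡ β′ j
        βj≡β′j = agree j (ℕP.≤∧≢⇒< (ℕP.≤-pred j<i+1) j≢i)
        j≢v : j ≢ v
        j≢v j≡v = j≢i (trans (cong toℕ j≡v) (FP.toℕ-fromℕ< i<n))

module GluingCount (k : ℕ) {N n₁ n₂ n : ℕ} {G : SGraph N} {G₁ : SGraph n₁} {G₂ : SGraph n₂}
                   (glue : Gluing G G₁ G₂ n) where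
  open Sums
  open Booleans
  open Colourings k
  open Symmetries k
  open Gluing glue
  open import Data.Bool using (true; false; _∧_)
  open import Data.Nat as ℕ using (_*_)
  import Data.Nat.Properties as ℕP
  open import Data.Nat.Tactic.RingSolver using (solve-∀)
  open import Data.Fin using (Fin)
  open import Data.Product using (_,_; proj₁; proj₂)
  open import Data.Sum using (_⊎_; inj₁; inj₂)
  open import Relation.Binary.PropositionalEquality
  open import Function using (_∘_)
  open ≡-Reasoning

  number-of-proper : ∀ {a} (H : SGraph a) → numColorings H k ≡ Σf a (ind ∘ isProper H k)
  number-of-proper {a} H = length-filter (isProper H k) (allFuns a M)

  module Side {a} (H : SGraph a) (f : Fin a → Fin N) (induced : IsInducedEmb H G f)
              (g : Fin n → Fin a) (fg≡h : ∀ c → f (g c) ≡ h c) where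

    extensions : Fn n → ℕ
    extensions β = Σf a (λ γ → ind (isProper H k γ) * ind (β ≐ γ ∘ g))

    overlap-hom : SignedHom (B n) H g
    overlap-hom = record
      { pos  = λ c d e → trans (pos≡ (g c) (g d))
                           (trans (cong₂ (posE G) (fg≡h c) (fg≡h d)) (trans (sym (h-pos c d)) e))
      ; neg  = λ c d e → trans (neg≡ (g c) (g d))
                           (trans (cong₂ (negE G) (fg≡h c) (fg≡h d)) (trans (sym (h-neg c d)) e))
      ; loop = λ c _ → trans (loop≡ (g c)) (trans (cong (loop G) (fg≡h c)) (sym (h-loop c))) }
      where
      pos≡ = proj₁ (proj₂ induced)
      neg≡ = proj₁ (proj₂ (proj₂ induced))
      loop≡ = proj₂ (proj₂ (proj₂ induced))
      h-pos = proj₁ (proj₂ h-induced)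
      h-neg = proj₁ (proj₂ (proj₂ h-induced))
      h-loop = proj₂ (proj₂ (proj₂ h-induced))

    count-by-restriction : numColorings H k ≡ Σf n extensions
    count-by-restriction = begin
      numColorings H k
        ≡⟨ number-of-proper H ⟩
      Σf a (λ γ → ind (isProper H k γ))
        ≡⟨ S-cong (allFuns a M) (λ γ → insert-unique n (γ ∘ g) (ind (isProper H k γ))) ⟩
      Σf a (λ γ → Σf n (λ β → ind (β ≐ γ ∘ g) * ind (isProper H k γ)))
        ≡⟨ S-swap (allFuns a M) (allFuns n M) _ ⟩
      Σf n (λ β → Σf a (λ γ → ind (β ≐ γ ∘ g) * ind (isProper H k γ)))
        ≡⟨ S-cong (allFuns n M) (λ β → S-cong (allFuns a M) (λ γ → ℕP.*-comm (ind (β ≐ γ ∘ g)) _)) ⟩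
      Σf n extensions ∎

    -- a colouring of the overlap with a proper extension is itself proper
    no-extensions : ∀ β → isProper (B n) k β ≡ false → extensions β ≡ 0
    no-extensions β improper = trans (S-cong (allFuns a M) vanishes) (S-0 (allFuns a M))
      where
      vanishes : ∀ γ → ind (isProper H k γ) * ind (β ≐ γ ∘ g) ≡ 0
      vanishes γ with isProper H k γ in proper-γ | β ≐ γ ∘ g in β≐γg
      ... | false | _     = refl
      ... | true  | false = refl
      ... | true  | true  with trans (sym improper) (proper-complete (B n) β
                                 (proper-resp (B n) (sym ∘ ≐-sound β (γ ∘ g) β≐γg)
                                   (restrict overlap-hom γ (proper-sound H γ proper-γ))))
      ...   | ()

    extensions-extensional : Extensional extensions
    extensions-extensional β β′ β≗β′ =
      S-cong (allFuns a M) λ γ → cong (λ b → ind (isProper H k γ) * ind b) (≐-resp β≗β′ (λ _ → refl))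

    -- reindexing by γ ↦ φ ∘ γ matches the extensions of β with those of φ ∘ β
    extensions-invariant : Invariant extensions
    extensions-invariant S β = begin
      extensions (φ ∘ β)
        ≡⟨ reindex-involution a φ (Symmetry.involutive S) F F-ext ⟩
      Σf a (λ γ → F (φ ∘ γ))
        ≡⟨ S-cong (allFuns a M) (λ γ → cong₂ (λ p q → ind p * ind q)
             (Symmetry.isProper-invariant S H γ) (φ-cancel γ)) ⟩
      extensions β ∎
      where
      φ = Symmetry.φ S
      F : Fn a → ℕ
      F γ = ind (isProper H k γ) * ind ((φ ∘ β) ≐ γ ∘ g)
      F-ext : Extensional F
      F-ext γ γ′ γ≗γ′ = cong₂ (λ p q → ind p * ind q) (isProper-resp H γ≗γ′) (≐-resp (λ _ → refl) (γ≗γ′ ∘ g))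
      φ-cancel : ∀ γ → ((φ ∘ β) ≐ φ ∘ γ ∘ g) ≡ (β ≐ γ ∘ g)
      φ-cancel γ = bool-ext
        (λ e → ≐-complete β (γ ∘ g) (λ c → Symmetry.injective S (≐-sound (φ ∘ β) (φ ∘ γ ∘ g) e c)))
        (λ e → ≐-complete (φ ∘ β) (φ ∘ γ ∘ g) (λ c → cong φ (≐-sound β (γ ∘ g) e c)))

    extensions-constant : ∀ β β′ → isProper (B n) k β ≡ true → isProper (B n) k β′ ≡ true →
                          extensions β ≡ extensions β′
    extensions-constant β β′ p p′ =
      invariant⇒constant extensions extensions-extensional extensions-invariant β β′
        (proper-sound (B n) β p) (proper-sound (B n) β′ p′)

  g₁ : Fin n → Fin n₁
  g₁ c = proj₁ (proj₁ (h-image₂ (h c) (c , refl)))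

  f₁g₁≡h : ∀ c → f₁ (g₁ c) ≡ h c
  f₁g₁≡h c = proj₂ (proj₁ (h-image₂ (h c) (c , refl)))

  g₂ : Fin n → Fin n₂
  g₂ c = proj₁ (proj₂ (h-image₂ (h c) (c , refl)))

  f₂g₂≡h : ∀ c → f₂ (g₂ c) ≡ h c
  f₂g₂≡h c = proj₂ (proj₂ (h-image₂ (h c) (c , refl)))

  module Side₁ = Side G₁ f₁ f₁-induced g₁ f₁g₁≡h
  module Side₂ = Side G₂ f₂ f₂-induced g₂ f₂g₂≡h

  -- every edge and loop of G lies in G₁ or G₂, so γ is proper once both restrictions are
  glued-proper : ∀ γ → Proper G₁ (γ ∘ f₁) → Proper G₂ (γ ∘ f₂) → Proper G γ
  glued-proper γ (pos₁ , neg₁ , loops₁) (pos₂ , neg₂ , loops₂) = pos , neg , loops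
    where
    pos : ∀ u v → posE G u v ≡ true → γ u ≢ γ v
    pos u v e γu≡γv with cover-pos u v e
    ... | inj₁ ((x , refl) , (y , refl)) = pos₁ x y (trans (proj₁ (proj₂ f₁-induced) x y) e) γu≡γv
    ... | inj₂ ((x , refl) , (y , refl)) = pos₂ x y (trans (proj₁ (proj₂ f₂-induced) x y) e) γu≡γv
    neg : ∀ u v → negE G u v ≡ true → γ u ≢ opp (γ v)
    neg u v e γu≡-γv with cover-neg u v e
    ... | inj₁ ((x , refl) , (y , refl)) = neg₁ x y (trans (proj₁ (proj₂ (proj₂ f₁-induced)) x y) e) γu≡-γv
    ... | inj₂ ((x , refl) , (y , refl)) = neg₂ x y (trans (proj₁ (proj₂ (proj₂ f₂-induced)) x y) e) γu≡-γv
    loops : ∀ u → loop G u ≡ true → γ u ≢ zero-colour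
    loops u e γu≡0 with cover-vertex u
    ... | inj₁ (x , refl) = loops₁ x (trans (proj₂ (proj₂ (proj₂ f₁-induced)) x) e) γu≡0
    ... | inj₂ (x , refl) = loops₂ x (trans (proj₂ (proj₂ (proj₂ f₂-induced)) x) e) γu≡0

  isProper-glued : ∀ γ → isProper G k γ ≡ isProper G₁ k (γ ∘ f₁) ∧ isProper G₂ k (γ ∘ f₂)
  isProper-glued γ = bool-ext
    (λ p → ∧-intro (proper-complete G₁ _ (restrict (induced⇒hom {H = G₁} {G = G} {e = f₁} f₁-induced) γ (proper-sound G γ p)))
                   (proper-complete G₂ _ (restrict (induced⇒hom {H = G₂} {G = G} {e = f₂} f₂-induced) γ (proper-sound G γ p))))
    (λ p → proper-complete G γ (glued-proper γ (proper-sound G₁ _ (∧-left p))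
                                               (proper-sound G₂ _ (∧-right {isProper G₁ k (γ ∘ f₁)} p))))

  -- Colourings γ₁ of G₁ and γ₂ of G₂ agreeing on the overlap have exactly one common
  -- extension to G (take γ₁ on V₁ and γ₂ on V₂); if they disagree there is none.
  amalgamations : ∀ γ₁ γ₂ → Σf N (λ γ → ind (γ₁ ≐ γ ∘ f₁) * ind (γ₂ ≐ γ ∘ f₂)) ≡ ind (γ₁ ∘ g₁ ≐ γ₂ ∘ g₂)
  amalgamations γ₁ γ₂ with γ₁ ∘ g₁ ≐ γ₂ ∘ g₂ in agree
  ... | false = trans (S-cong (allFuns N M) no-common) (S-0 (allFuns N M))
    where
    no-common : ∀ γ → ind (γ₁ ≐ γ ∘ f₁) * ind (γ₂ ≐ γ ∘ f₂) ≡ 0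
    no-common γ with γ₁ ≐ γ ∘ f₁ in e₁ | γ₂ ≐ γ ∘ f₂ in e₂
    ... | false | _     = refl
    ... | true  | false = refl
    ... | true  | true  with trans (sym agree) (≐-complete (γ₁ ∘ g₁) (γ₂ ∘ g₂) λ c → begin
                                γ₁ (g₁ c)      ≡⟨ ≐-sound γ₁ (γ ∘ f₁) e₁ (g₁ c) ⟩
                                γ (f₁ (g₁ c))  ≡⟨ cong γ (trans (f₁g₁≡h c) (sym (f₂g₂≡h c))) ⟩
                                γ (f₂ (g₂ c))  ≡⟨ ≐-sound γ₂ (γ ∘ f₂) e₂ (g₂ c) ⟨
                                γ₂ (g₂ c)      ∎)
    ...   | ()
  ... | true = trans (S-cong (allFuns N M) common) (enumerated-once N γ*)
    where
    compatible : ∀ x y → f₁ x ≡ f₂ y → γ₁ x ≡ γ₂ y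
    compatible x y f₁x≡f₂y with h-image₁ (f₁ x) (x , refl) (y , sym f₁x≡f₂y)
    ... | c , hc≡f₁x = begin
      γ₁ x        ≡⟨ cong γ₁ (proj₁ f₁-induced (trans (f₁g₁≡h c) hc≡f₁x)) ⟨
      γ₁ (g₁ c)   ≡⟨ ≐-sound (γ₁ ∘ g₁) (γ₂ ∘ g₂) agree c ⟩
      γ₂ (g₂ c)   ≡⟨ cong γ₂ (proj₁ f₂-induced (trans (f₂g₂≡h c) (trans hc≡f₁x f₁x≡f₂y))) ⟩
      γ₂ y        ∎
    pick : ∀ {v} → InImage f₁ v ⊎ InImage f₂ v → Col
    pick (inj₁ (x , _)) = γ₁ x
    pick (inj₂ (y , _)) = γ₂ y
    γ* : Fn N
    γ* v = pick (cover-vertex v)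
    γ*∘f₁ : ∀ x → γ* (f₁ x) ≡ γ₁ x
    γ*∘f₁ x with cover-vertex (f₁ x)
    ... | inj₁ (x′ , f₁x′≡f₁x) = cong γ₁ (proj₁ f₁-induced f₁x′≡f₁x)
    ... | inj₂ (y , f₂y≡f₁x)   = sym (compatible x y (sym f₂y≡f₁x))
    γ*∘f₂ : ∀ y → γ* (f₂ y) ≡ γ₂ y
    γ*∘f₂ y with cover-vertex (f₂ y)
    ... | inj₁ (x , f₁x≡f₂y)   = compatible x y f₁x≡f₂y
    ... | inj₂ (y′ , f₂y′≡f₂y) = cong γ₂ (proj₁ f₂-induced f₂y′≡f₂y)
    common : ∀ γ → ind (γ₁ ≐ γ ∘ f₁) * ind (γ₂ ≐ γ ∘ f₂) ≡ ind (γ ≐ γ*)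
    common γ = trans (sym (ind-∧ (γ₁ ≐ γ ∘ f₁) _)) (cong ind (bool-ext
      (λ e → ≐-complete γ γ* λ v → agrees v (cover-vertex v)
               (≐-sound γ₁ (γ ∘ f₁) (∧-left e)) (≐-sound γ₂ (γ ∘ f₂) (∧-right {γ₁ ≐ γ ∘ f₁} e)))
      (λ e → ∧-intro (≐-complete γ₁ (γ ∘ f₁) λ x → sym (trans (≐-sound γ γ* e (f₁ x)) (γ*∘f₁ x)))
                     (≐-complete γ₂ (γ ∘ f₂) λ y → sym (trans (≐-sound γ γ* e (f₂ y)) (γ*∘f₂ y))))))
      where
      agrees : ∀ v (s : InImage f₁ v ⊎ InImage f₂ v) → γ₁ ≗ γ ∘ f₁ → γ₂ ≗ γ ∘ f₂ → γ v ≡ pick s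
      agrees v (inj₁ (x , refl)) γ₁≗ _ = sym (γ₁≗ x)
      agrees v (inj₂ (y , refl)) _ γ₂≗ = sym (γ₂≗ y)

  restriction-sum : (F : Fn n₁ → Fn n₂ → ℕ) →
    (∀ {γ₁ γ₁′ γ₂ γ₂′} → γ₁ ≗ γ₁′ → γ₂ ≗ γ₂′ → F γ₁ γ₂ ≡ F γ₁′ γ₂′) →
    Σf N (λ γ → F (γ ∘ f₁) (γ ∘ f₂)) ≡ Σf n₁ (λ γ₁ → Σf n₂ (λ γ₂ → ind (γ₁ ∘ g₁ ≐ γ₂ ∘ g₂) * F γ₁ γ₂))
  restriction-sum F F-ext = begin
    Σf N (λ γ → F (γ ∘ f₁) (γ ∘ f₂))
      ≡⟨ S-cong L (λ γ → sym (sift-both γ)) ⟩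
    Σf N (λ γ → Σf n₁ (λ γ₁ → Σf n₂ (λ γ₂ → ind (γ₁ ≐ γ ∘ f₁) * (ind (γ₂ ≐ γ ∘ f₂) * F γ₁ γ₂))))
      ≡⟨ S-swap L L₁ _ ⟩
    Σf n₁ (λ γ₁ → Σf N (λ γ → Σf n₂ (λ γ₂ → ind (γ₁ ≐ γ ∘ f₁) * (ind (γ₂ ≐ γ ∘ f₂) * F γ₁ γ₂))))
      ≡⟨ S-cong L₁ (λ γ₁ → S-swap L L₂ _) ⟩
    Σf n₁ (λ γ₁ → Σf n₂ (λ γ₂ → Σf N (λ γ → ind (γ₁ ≐ γ ∘ f₁) * (ind (γ₂ ≐ γ ∘ f₂) * F γ₁ γ₂))))
      ≡⟨ S-cong L₁ (λ γ₁ → S-cong L₂ (λ γ₂ → count-amalgamations γ₁ γ₂)) ⟩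
    Σf n₁ (λ γ₁ → Σf n₂ (λ γ₂ → ind (γ₁ ∘ g₁ ≐ γ₂ ∘ g₂) * F γ₁ γ₂)) ∎
    where
    L = allFuns N M
    L₁ = allFuns n₁ M
    L₂ = allFuns n₂ M
    sift-both : ∀ γ → Σf n₁ (λ γ₁ → Σf n₂ (λ γ₂ → ind (γ₁ ≐ γ ∘ f₁) * (ind (γ₂ ≐ γ ∘ f₂) * F γ₁ γ₂)))
                      ≡ F (γ ∘ f₁) (γ ∘ f₂)
    sift-both γ = begin
      Σf n₁ (λ γ₁ → Σf n₂ (λ γ₂ → ind (γ₁ ≐ γ ∘ f₁) * (ind (γ₂ ≐ γ ∘ f₂) * F γ₁ γ₂)))
        ≡⟨ S-cong L₁ (λ γ₁ → S-*ˡ L₂ (ind (γ₁ ≐ γ ∘ f₁)) _) ⟩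
      Σf n₁ (λ γ₁ → ind (γ₁ ≐ γ ∘ f₁) * Σf n₂ (λ γ₂ → ind (γ₂ ≐ γ ∘ f₂) * F γ₁ γ₂))
        ≡⟨ S-cong L₁ (λ γ₁ → cong (ind (γ₁ ≐ γ ∘ f₁) *_)
             (sift n₂ (γ ∘ f₂) (F γ₁) (λ _ _ γ₂≗γ₂′ → F-ext (λ _ → refl) γ₂≗γ₂′))) ⟩
      Σf n₁ (λ γ₁ → ind (γ₁ ≐ γ ∘ f₁) * F γ₁ (γ ∘ f₂))
        ≡⟨ sift n₁ (γ ∘ f₁) (λ γ₁ → F γ₁ (γ ∘ f₂)) (λ _ _ γ₁≗γ₁′ → F-ext γ₁≗γ₁′ (λ _ → refl)) ⟩
      F (γ ∘ f₁) (γ ∘ f₂) ∎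
    count-amalgamations : ∀ γ₁ γ₂ → Σf N (λ γ → ind (γ₁ ≐ γ ∘ f₁) * (ind (γ₂ ≐ γ ∘ f₂) * F γ₁ γ₂))
                                    ≡ ind (γ₁ ∘ g₁ ≐ γ₂ ∘ g₂) * F γ₁ γ₂
    count-amalgamations γ₁ γ₂ =
      trans (S-cong L (λ γ → sym (ℕP.*-assoc (ind (γ₁ ≐ γ ∘ f₁)) _ _)))
            (trans (S-*ʳ L (F γ₁ γ₂) _) (cong (_* F γ₁ γ₂) (amalgamations γ₁ γ₂)))

  count-glued : numColorings G k ≡ Σf n (λ β → Side₁.extensions β * Side₂.extensions β)
  count-glued = begin
    numColorings G k
      ≡⟨ number-of-proper G ⟩
    Σf N (λ γ → ind (isProper G k γ))
      ≡⟨ S-cong (allFuns N M) (λ γ → trans (cong ind (isProper-glued γ)) (ind-∧ (isProper G₁ k (γ ∘ f₁)) _)) ⟩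
    Σf N (λ γ → P₁ (γ ∘ f₁) * P₂ (γ ∘ f₂))
      ≡⟨ restriction-sum (λ γ₁ γ₂ → P₁ γ₁ * P₂ γ₂)
           (λ γ₁≗ γ₂≗ → cong₂ (λ p q → ind p * ind q) (isProper-resp G₁ γ₁≗) (isProper-resp G₂ γ₂≗)) ⟩
    Σf n₁ (λ γ₁ → Σf n₂ (λ γ₂ → ind (γ₁ ∘ g₁ ≐ γ₂ ∘ g₂) * (P₁ γ₁ * P₂ γ₂)))
      ≡⟨ S-cong L₁ (λ γ₁ → S-cong L₂ (λ γ₂ → split-agreement γ₁ γ₂)) ⟩
    Σf n₁ (λ γ₁ → Σf n₂ (λ γ₂ → Σf n (λ β → Term β γ₁ γ₂)))
      ≡⟨ S-cong L₁ (λ γ₁ → S-swap L₂ Lₙ _) ⟩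
    Σf n₁ (λ γ₁ → Σf n (λ β → Σf n₂ (λ γ₂ → Term β γ₁ γ₂)))
      ≡⟨ S-swap L₁ Lₙ _ ⟩
    Σf n (λ β → Σf n₁ (λ γ₁ → Σf n₂ (λ γ₂ → Term β γ₁ γ₂)))
      ≡⟨ S-cong Lₙ (λ β → sym (S-*-S L₁ L₂ _ _)) ⟩
    Σf n (λ β → Side₁.extensions β * Side₂.extensions β) ∎
    where
    L₁ = allFuns n₁ M
    L₂ = allFuns n₂ M
    Lₙ = allFuns n M
    P₁ = ind ∘ isProper G₁ k
    P₂ = ind ∘ isProper G₂ k
    Term : Fn n → Fn n₁ → Fn n₂ → ℕ
    Term β γ₁ γ₂ = (P₁ γ₁ * ind (β ≐ γ₁ ∘ g₁)) * (P₂ γ₂ * ind (β ≐ γ₂ ∘ g₂))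
    -- agreeing on the overlap means having a common restriction β there
    split-agreement : ∀ γ₁ γ₂ → ind (γ₁ ∘ g₁ ≐ γ₂ ∘ g₂) * (P₁ γ₁ * P₂ γ₂) ≡ Σf n (λ β → Term β γ₁ γ₂)
    split-agreement γ₁ γ₂ = begin
      ind (γ₁ ∘ g₁ ≐ γ₂ ∘ g₂) * (P₁ γ₁ * P₂ γ₂)
        ≡⟨ cong (_* (P₁ γ₁ * P₂ γ₂)) (sym (sift n (γ₁ ∘ g₁) (λ β → ind (β ≐ γ₂ ∘ g₂))
             (λ β β′ β≗β′ → cong ind (≐-resp β≗β′ (λ _ → refl))))) ⟩
      Σf n (λ β → ind (β ≐ γ₁ ∘ g₁) * ind (β ≐ γ₂ ∘ g₂)) * (P₁ γ₁ * P₂ γ₂)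
        ≡⟨ sym (S-*ʳ Lₙ _ _) ⟩
      Σf n (λ β → ind (β ≐ γ₁ ∘ g₁) * ind (β ≐ γ₂ ∘ g₂) * (P₁ γ₁ * P₂ γ₂))
        ≡⟨ S-cong Lₙ (λ β → regroup (ind (β ≐ γ₁ ∘ g₁)) (ind (β ≐ γ₂ ∘ g₂)) (P₁ γ₁) (P₂ γ₂)) ⟩
      Σf n (λ β → Term β γ₁ γ₂) ∎
      where
      regroup : ∀ a b c d → a * b * (c * d) ≡ (c * a) * (d * b)
      regroup = solve-∀

  counting-identity : numColorings G k * numColorings (B n) k ≡ numColorings G₁ k * numColorings G₂ k
  counting-identity = begin
    numColorings G k * numColorings (B n) k
      ≡⟨ cong₂ _*_ count-glued (number-of-proper (B n)) ⟩
    Σf n (λ β → Side₁.extensions β * Side₂.extensions β) * Σf n (ind ∘ isProper (B n) k)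
      ≡⟨ product-formula (allFuns n M) (isProper (B n) k) Side₁.extensions Side₂.extensions
           Side₁.no-extensions Side₂.no-extensions Side₂.extensions-constant ⟩
    Σf n Side₁.extensions * Σf n Side₂.extensions
      ≡⟨ sym (cong₂ _*_ Side₁.count-by-restriction Side₂.count-by-restriction) ⟩
    numColorings G₁ k * numColorings G₂ k ∎

module Chordality where
  open Sums using (S; S-cong; S-+; ind; length-filter)
  open Booleans using (⌊⌋-true; ⌊⌋-false)
  open import Data.Bool using (Bool; true; false; _∧_; not; if_then_else_)
  open import Data.Nat as ℕ using (ℕ; zero; suc; _≤_; _<_; s≤s; z≤n; _∸_; _≤?_; _<?_)
  import Data.Nat.Properties as ℕP
  open import Data.Nat.Divisibility using (_∣_; divides; ∣m∣n⇒∣m+n; ∣m+n∣m⇒∣n)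
  open import Data.Nat.Tactic.RingSolver using (solve-∀)
  open import Data.Fin as Fin using (Fin; toℕ; fromℕ)
  import Data.Fin.Properties as FP
  open import Data.List using (allFin)
  open import Data.Product using (∃; _×_; _,_; proj₁; proj₂)
  import Data.Product as Prod
  open import Data.Sum using (_⊎_; inj₁; inj₂)
  import Data.Sum as Sum
  open import Data.Empty using (⊥-elim)
  open import Relation.Nullary using (¬_; yes; no)
  open import Relation.Nullary.Decidable using (⌊_⌋)
  open import Relation.Unary using (Decidable)
  open import Relation.Binary using (tri<; tri≈; tri>)
  open import Relation.Binary.PropositionalEquality
  open import Function using (_∘_)

  interval-split : ∀ {a b c} t → a ≤ b → b ≤ c →
    ind (⌊ a ≤? t ⌋ ∧ ⌊ t <? c ⌋) ≡ ind (⌊ a ≤? t ⌋ ∧ ⌊ t <? b ⌋) ℕ.+ ind (⌊ b ≤? t ⌋ ∧ ⌊ t <? c ⌋)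
  interval-split {a} {b} {c} t a≤b b≤c with t <? b | b ≤? t
  ... | yes t<b | yes b≤t = ⊥-elim (ℕP.<⇒≱ t<b b≤t)
  ... | no t≮b  | no b≰t  = ⊥-elim (b≰t (ℕP.≮⇒≥ t≮b))
  ... | yes t<b | no _    =
        trans (cong (λ x → ind (⌊ a ≤? t ⌋ ∧ x)) (⌊⌋-true (t <? c) (ℕP.<-≤-trans t<b b≤c)))
              (sym (ℕP.+-identityʳ _))
  ... | no _    | yes b≤t =
        trans (cong (λ x → ind (x ∧ ⌊ t <? c ⌋)) a≤t)
              (sym (cong (λ x → ind (x ∧ false) ℕ.+ ind ⌊ t <? c ⌋) a≤t))
    where
    a≤t = ⌊⌋-true (a ≤? t) (ℕP.≤-trans a≤b b≤t)

  negsIn-split : ∀ {k} (s : Fin k → Sgn) a b c → a ≤ b → b ≤ c →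
                 negsIn s a c ≡ negsIn s a b ℕ.+ negsIn s b c
  negsIn-split {k} s a b c a≤b b≤c = begin
    negsIn s a c
      ≡⟨ length-filter _ (allFin k) ⟩
    S (allFin k) (ind ∘ negIn a c)
      ≡⟨ S-cong (allFin k) pointwise ⟩
    S (allFin k) (λ i → ind (negIn a b i) ℕ.+ ind (negIn b c i))
      ≡⟨ S-+ (allFin k) _ _ ⟩
    S (allFin k) (ind ∘ negIn a b) ℕ.+ S (allFin k) (ind ∘ negIn b c)
      ≡⟨ sym (cong₂ ℕ._+_ (length-filter _ (allFin k)) (length-filter _ (allFin k))) ⟩
    negsIn s a b ℕ.+ negsIn s b c ∎
    where
    open ≡-Reasoning
    negIn : ℕ → ℕ → Fin k → Bool
    negIn x y i = isNeg (s i) ∧ ⌊ x ≤? toℕ i ⌋ ∧ ⌊ toℕ i <? y ⌋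
    pointwise : ∀ i → ind (negIn a c i) ≡ ind (negIn a b i) ℕ.+ ind (negIn b c i)
    pointwise i with isNeg (s i)
    ... | true  = interval-split (toℕ i) a≤b b≤c
    ... | false = refl

  even-or-odd : ∀ y → 2 ∣ y ⊎ 2 ∣ suc y
  even-or-odd zero    = inj₁ (divides 0 refl)
  even-or-odd (suc y) with even-or-odd y
  ... | inj₁ (divides q y≡q*2) = inj₂ (divides (suc q) (cong (λ z → suc (suc z)) y≡q*2))
  ... | inj₂ 2∣1+y            = inj₁ 2∣1+y

  even-complement : ∀ x y z b → 2 ∣ x ℕ.+ (y ℕ.+ z) → 2 ∣ y ℕ.+ b → 2 ∣ x ℕ.+ z ℕ.+ b
  even-complement x y z b 2∣x+y+z 2∣y+b =
    ∣m+n∣m⇒∣n (subst (2 ∣_) (regroup x y z b) (∣m∣n⇒∣m+n 2∣x+y+z (divides b (double b)))) 2∣y+b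
    where
    regroup : ∀ x y z b → x ℕ.+ (y ℕ.+ z) ℕ.+ (b ℕ.+ b) ≡ y ℕ.+ b ℕ.+ (x ℕ.+ z ℕ.+ b)
    regroup = solve-∀
    double : ∀ b → b ℕ.+ b ≡ b ℕ.* 2
    double = solve-∀

  -- In a balanced cycle, two vertices v_i, v_j that are far apart on the cycle and
  -- joined by edges of both signs give a balanced chord: the sign is chosen so that
  -- the cycle v_i … v_j closed by the chord is balanced, and then so is the other one.
  doubly-joined⇒balanced-chord :
    ∀ {N} {G : SGraph N} {m} (C : Cycle G m) → Balanced C →
    (i j : Fin (3 ℕ.+ m)) → 2 ℕ.+ toℕ i ≤ toℕ j → 2 ℕ.+ toℕ j ≤ (3 ℕ.+ m) ℕ.+ toℕ i →
    (∀ σ → HasEdge G σ (vert C i) (vert C j)) → BalancedChord C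
  doubly-joined⇒balanced-chord {m = m} C balanced i j gap₁ gap₂ joined = choose-sign (even-or-odd inner)
    where
    s = sgn C
    L = 3 ℕ.+ m
    inner = negsIn s (toℕ i) (toℕ j)
    i≤j : toℕ i ≤ toℕ j
    i≤j = ℕP.≤-trans (ℕP.m≤n+m (toℕ i) 2) gap₁
    j≤L : toℕ j ≤ L
    j≤L = ℕP.<⇒≤ (FP.toℕ<n j)
    total : 2 ∣ negsIn s 0 (toℕ i) ℕ.+ (inner ℕ.+ negsIn s (toℕ j) L)
    total = subst (2 ∣_) (trans (negsIn-split s 0 (toℕ i) L z≤n (ℕP.≤-trans i≤j j≤L))
                                (cong (negsIn s 0 (toℕ i) ℕ.+_) (negsIn-split s (toℕ i) (toℕ j) L i≤j j≤L)))
                         balanced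
    chord : ∀ σ → 2 ∣ inner ℕ.+ (if isNeg σ then 1 else 0) → BalancedChord C
    chord σ bal₁ = record
      { i = i ; j = j ; σ = σ ; gap₁ = gap₁ ; gap₂ = gap₂ ; edge = joined σ ; bal₁ = bal₁
      ; bal₂ = even-complement (negsIn s 0 (toℕ i)) inner (negsIn s (toℕ j) L) _ total bal₁ }
    choose-sign : 2 ∣ inner ⊎ 2 ∣ suc inner → BalancedChord C
    choose-sign (inj₁ 2∣inner)   = chord ⊕ (subst (2 ∣_) (sym (ℕP.+-identityʳ inner)) 2∣inner)
    choose-sign (inj₂ 2∣1+inner) = chord ⊖ (subst (2 ∣_) (ℕP.+-comm 1 inner) 2∣1+inner)

  module InducedCycle {N a : ℕ} {G : SGraph N} {H : SGraph a}
                      (f : Fin a → Fin N) (induced : IsInducedEmb H G f) where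

    edge-reflected : ∀ σ x y → HasEdge G σ (f x) (f y) → HasEdge H σ x y
    edge-reflected ⊕ x y e = trans (proj₁ (proj₂ induced) x y) e
    edge-reflected ⊖ x y e = trans (proj₁ (proj₂ (proj₂ induced)) x y) e

    edge-preserved : ∀ σ x y → HasEdge H σ x y → HasEdge G σ (f x) (f y)
    edge-preserved ⊕ x y e = trans (sym (proj₁ (proj₂ induced) x y)) e
    edge-preserved ⊖ x y e = trans (sym (proj₁ (proj₂ (proj₂ induced)) x y)) e

    chord-in-subgraph : BalancedChordal H → ∀ m → 1 ≤ m → (C : Cycle G m) → Balanced C →
                        (∀ i → InImage f (vert C i)) → BalancedChord C
    chord-in-subgraph chordal m 1≤m C balanced inside = lift (chordal m 1≤m C′ balanced)
      where
      v′ : Fin (3 ℕ.+ m) → Fin a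
      v′ i = proj₁ (inside i)
      fv′ : ∀ i → f (v′ i) ≡ vert C i
      fv′ i = proj₂ (inside i)
      C′ : Cycle H m
      C′ = record
        { vert     = v′
        ; sgn      = sgn C
        ; distinct = λ {i} {j} e → distinct C (trans (sym (fv′ i)) (trans (cong f e) (fv′ j)))
        ; edges    = λ i → edge-reflected (sgn C i) _ _
                       (subst₂ (HasEdge G (sgn C i)) (sym (fv′ i)) (sym (fv′ (next i))) (edges C i))
        }
      lift : BalancedChord C′ → BalancedChord C
      lift ch = record
        { i = i ; j = j ; σ = σ ; gap₁ = gap₁ ; gap₂ = gap₂ ; bal₁ = bal₁ ; bal₂ = bal₂
        ; edge = subst₂ (HasEdge G σ) (fv′ i) (fv′ j) (edge-preserved σ _ _ edge) }
        where open BalancedChord ch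

  next-suc : ∀ {K} (i : Fin (suc K)) → toℕ i < K → toℕ (next i) ≡ suc (toℕ i)
  next-suc {K} i i<K with toℕ i ℕ.<? K
  ... | yes p = FP.toℕ-fromℕ< (s≤s p)
  ... | no ¬p = ⊥-elim (¬p i<K)

  next-last : ∀ K → next (fromℕ K) ≡ Fin.zero
  next-last K with toℕ (fromℕ K) ℕ.<? K
  ... | yes K<K = ⊥-elim (ℕP.<-irrefl (FP.toℕ-fromℕ K) K<K)
  ... | no _    = refl

  advance : ∀ {K} d (a b : Fin (suc K)) → toℕ b ≡ suc d ℕ.+ toℕ a →
            toℕ a < toℕ b × toℕ (next a) ≡ suc (toℕ a) × toℕ b ≡ d ℕ.+ toℕ (next a)
  advance d a b b≡ = a<b , next≡ , trans b≡ (trans (sym (ℕP.+-suc d (toℕ a))) (cong (d ℕ.+_) (sym next≡)))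
    where
    a<b : toℕ a < toℕ b
    a<b = subst (toℕ a <_) (sym b≡) (s≤s (ℕP.m≤n+m (toℕ a) d))
    next≡ : toℕ (next a) ≡ suc (toℕ a)
    next≡ = next-suc a (ℕP.<-≤-trans a<b (ℕP.≤-pred (FP.toℕ<n b)))

  record FarPair (K : ℕ) (X Y : Fin (suc K) → Set) : Set where
    field
      i j    : Fin (suc K)
      both-i : X i × Y i
      both-j : X j × Y j
      gap₁   : 2 ℕ.+ toℕ i ≤ toℕ j
      gap₂   : 2 ℕ.+ toℕ j ≤ suc K ℕ.+ toℕ i

  -- Walking along it, every change
  -- between X and non-X happens at a position of X ∩ Y.
  module Crossings (K : ℕ) (X Y : Fin (suc K) → Set) (X? : Decidable X)
                   (covered : ∀ i → X i ⊎ Y i)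
                   (step : ∀ i → (X i × X (next i)) ⊎ (Y i × Y (next i))) where

    Both : Fin (suc K) → Set
    Both i = X i × Y i

    enter : ∀ a b → ¬ X a → X b → toℕ a ≤ toℕ b → ∃ λ r → toℕ a < toℕ r × toℕ r ≤ toℕ b × Both r
    enter a b ¬Xa Xb a≤b = walk (toℕ b ∸ toℕ a) a (sym (ℕP.m∸n+n≡m a≤b)) ¬Xa
      where
      walk : ∀ d a → toℕ b ≡ d ℕ.+ toℕ a → ¬ X a → ∃ λ r → toℕ a < toℕ r × toℕ r ≤ toℕ b × Both r
      walk zero    a b≡a ¬Xa = ⊥-elim (¬Xa (subst X (FP.toℕ-injective b≡a) Xb))
      walk (suc d) a b≡ ¬Xa with advance d a b b≡ | step a | X? (next a)
      ... | _ | inj₁ (Xa , _) | _ = ⊥-elim (¬Xa Xa)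
      ... | a<b , next≡ , _ | inj₂ (_ , Y-next) | yes X-next =
            next a , ℕP.≤-reflexive (sym next≡) , subst (_≤ toℕ b) (sym next≡) a<b , X-next , Y-next
      ... | _ , next≡ , b≡′ | inj₂ _ | no ¬X-next with walk d (next a) b≡′ ¬X-next
      ...   | r , next<r , r≤b , both-r = r , ℕP.<-trans (ℕP.≤-reflexive (sym next≡)) next<r , r≤b , both-r

    leave : ∀ a b → X a → ¬ X b → toℕ a ≤ toℕ b → ∃ λ r → toℕ a ≤ toℕ r × toℕ r < toℕ b × Both r
    leave a b Xa ¬Xb a≤b = walk (toℕ b ∸ toℕ a) a (sym (ℕP.m∸n+n≡m a≤b)) Xa
      where
      walk : ∀ d a → toℕ b ≡ d ℕ.+ toℕ a → X a → ∃ λ r → toℕ a ≤ toℕ r × toℕ r < toℕ b × Both r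
      walk zero    a b≡a Xa = ⊥-elim (¬Xb (subst X (sym (FP.toℕ-injective b≡a)) Xa))
      walk (suc d) a b≡ Xa with advance d a b b≡ | X? (next a)
      ... | a<b , _ , _ | no ¬X-next with step a
      ...   | inj₁ (_ , X-next) = ⊥-elim (¬X-next X-next)
      ...   | inj₂ (Ya , _)     = a , ℕP.≤-refl , a<b , Xa , Ya
      walk (suc d) a b≡ Xa | _ , next≡ , b≡′ | yes X-next with walk d (next a) b≡′ X-next
      ... | r , next≤r , r<b , both-r =
            r , ℕP.≤-trans (ℕP.n≤1+n (toℕ a)) (subst (_≤ toℕ r) next≡ next≤r) , r<b , both-r

    -- Let p < q with p ∉ X and q ∉ Y.  Then X ∩ Y meets the arc strictly between
    -- p and q, and also the complementary arc (through the wrap-around edge K → 0).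
    module _ (p q : Fin (suc K)) (p<q : toℕ p < toℕ q) (¬Xp : ¬ X p) (¬Yq : ¬ Y q) where

      Xq : X q
      Xq = Sum.[ (λ Xq → Xq) , (λ Yq → ⊥-elim (¬Yq Yq)) ] (covered q)

      -- entering X between p and q; the crossing is not q itself, as q ∉ Y
      inside : ∃ λ r → toℕ p < toℕ r × toℕ r < toℕ q × Both r
      inside with enter p q ¬Xp Xq (ℕP.<⇒≤ p<q)
      ... | r , p<r , r≤q , both-r@(_ , Yr) =
            r , p<r , ℕP.≤∧≢⇒< r≤q (λ r≡q → ¬Yq (subst Y (FP.toℕ-injective r≡q) Yr)) , both-r

      -- leaving X after q or before p: if 0 ∈ X, X is left before p; otherwise the
      -- wrap-around edge K → 0 is in Y, and X is left at K or before it, after q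
      outside : ∃ λ s → (toℕ s < toℕ p ⊎ toℕ q < toℕ s) × Both s
      outside with X? Fin.zero
      ... | yes X0 with leave Fin.zero p X0 ¬Xp z≤n
      ...   | s , _ , s<p , both-s = s , inj₁ s<p , both-s
      outside | no ¬X0 with X? (fromℕ K)
      ... | yes XK = fromℕ K , inj₂ q<K , XK , YK
        where
        YK : Y (fromℕ K)
        YK with step (fromℕ K)
        ... | inj₁ (_ , X0) = ⊥-elim (¬X0 (subst X (next-last K) X0))
        ... | inj₂ (YK , _) = YK
        q<K : toℕ q < toℕ (fromℕ K)
        q<K = ℕP.≤∧≢⇒< (ℕP.≤-trans (ℕP.≤-pred (FP.toℕ<n q)) (ℕP.≤-reflexive (sym (FP.toℕ-fromℕ K))))
                        (λ q≡K → ¬Yq (subst Y (sym (FP.toℕ-injective q≡K)) YK))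
      ... | no ¬XK with leave q (fromℕ K) Xq ¬XK (ℕP.≤-trans (ℕP.≤-pred (FP.toℕ<n q)) (ℕP.≤-reflexive (sym (FP.toℕ-fromℕ K))))
      ...   | s , q≤s , _ , both-s@(_ , Ys) =
              s , inj₂ (ℕP.≤∧≢⇒< q≤s (λ q≡s → ¬Yq (subst Y (sym (FP.toℕ-injective q≡s)) Ys))) , both-s

      -- the two crossings are separated by p and q, hence at cyclic distance ≥ 2
      far-pair : FarPair K X Y
      far-pair with inside | outside
      ... | r , p<r , r<q , both-r | s , inj₁ s<p , both-s = record
            { i = s ; j = r ; both-i = both-s ; both-j = both-r
            ; gap₁ = ℕP.≤-trans (s≤s s<p) p<r
            ; gap₂ = ℕP.≤-trans (s≤s (ℕP.<-≤-trans r<q (ℕP.≤-pred (FP.toℕ<n q)))) (ℕP.m≤m+n (suc K) (toℕ s)) }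
      ... | r , p<r , r<q , both-r | s , inj₂ q<s , both-s = record
            { i = r ; j = s ; both-i = both-r ; both-j = both-s
            ; gap₁ = ℕP.≤-trans (s≤s r<q) q<s
            ; gap₂ = s≤s (subst (ℕ._≤ K ℕ.+ toℕ r) (ℕP.+-comm (toℕ s) 1)
                          (ℕP.+-mono-≤ (ℕP.≤-pred (FP.toℕ<n s)) (ℕP.≤-trans (s≤s z≤n) p<r))) }

  far-pair-swap : ∀ {K} {X Y : Fin (suc K) → Set} → FarPair K Y X → FarPair K X Y
  far-pair-swap pair = record
    { i = i ; j = j ; both-i = Prod.swap both-i ; both-j = Prod.swap both-j ; gap₁ = gap₁ ; gap₂ = gap₂ }
    where open FarPair pair

  module _ {N n₁ n₂ n : ℕ} {G : SGraph N} {G₁ : SGraph n₁} {G₂ : SGraph n₂}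
           (glue : Gluing G G₁ G₂ n) where
    open Gluing glue

    InImage? : ∀ {a} (f : Fin a → Fin N) → Decidable (InImage f)
    InImage? f v = FP.any? (λ a → f a FP.≟ v)

    overlap-doubly-joined : ∀ u v → InImage f₁ u × InImage f₂ u → InImage f₁ v × InImage f₂ v →
                            u ≢ v → ∀ σ → HasEdge G σ u v
    overlap-doubly-joined u v (u₁ , u₂) (v₁ , v₂) u≢v
      with h-image₁ u u₁ u₂ | h-image₁ v v₁ v₂
    ... | c , hc≡u | d , hd≡v = λ σ → subst₂ (HasEdge G σ) hc≡u hd≡v (edge-in-B σ)
      where
      c≢d : c ≢ d
      c≢d c≡d = u≢v (trans (sym hc≡u) (trans (cong h c≡d) hd≡v))
      B-edge : not (c == d) ≡ true
      B-edge = cong not (⌊⌋-false (c FP.≟ d) c≢d)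
      edge-in-B : ∀ σ → HasEdge G σ (h c) (h d)
      edge-in-B ⊕ = trans (sym (proj₁ (proj₂ h-induced) c d)) B-edge
      edge-in-B ⊖ = trans (sym (proj₁ (proj₂ (proj₂ h-induced)) c d)) B-edge

    -- positions of the cycle in V₁ (X) and V₂ (Y) satisfy the hypotheses of Crossings
    gluing-balanced-chordal : BalancedChordal G₁ → BalancedChordal G₂ → BalancedChordal G
    gluing-balanced-chordal chordal₁ chordal₂ m 1≤m C balanced
      with FP.all? (λ i → InImage? f₁ (vert C i)) | FP.all? (λ i → InImage? f₂ (vert C i))
    ... | yes inside₁ | _ = InducedCycle.chord-in-subgraph f₁ f₁-induced chordal₁ m 1≤m C balanced inside₁
    ... | no _ | yes inside₂ = InducedCycle.chord-in-subgraph f₂ f₂-induced chordal₂ m 1≤m C balanced inside₂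
    ... | no ¬inside₁ | no ¬inside₂ =
          crossing-cycle (FP.¬∀⟶∃¬ _ X (λ i → InImage? f₁ (vert C i)) ¬inside₁)
                         (FP.¬∀⟶∃¬ _ Y (λ i → InImage? f₂ (vert C i)) ¬inside₂)
      where
      K = 2 ℕ.+ m
      X Y : Fin (suc K) → Set
      X i = InImage f₁ (vert C i)
      Y i = InImage f₂ (vert C i)
      covered : ∀ i → X i ⊎ Y i
      covered i = cover-vertex (vert C i)
      step : ∀ i → (X i × X (next i)) ⊎ (Y i × Y (next i))
      step i with sgn C i | edges C i
      ... | ⊕ | e = cover-pos _ _ e
      ... | ⊖ | e = cover-neg _ _ e
      far-pair⇒chord : FarPair K X Y → BalancedChord C
      far-pair⇒chord pair =
        doubly-joined⇒balanced-chord C balanced i j gap₁ gap₂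
          (overlap-doubly-joined _ _ both-i both-j
            (λ vi≡vj → ℕP.<-irrefl (cong toℕ (distinct C vi≡vj)) (ℕP.≤-trans (ℕP.n≤1+n _) gap₁)))
        where open FarPair pair
      crossing-cycle : (∃ λ p → ¬ X p) → (∃ λ q → ¬ Y q) → BalancedChord C
      crossing-cycle (p , ¬Xp) (q , ¬Yq) with ℕP.<-cmp (toℕ p) (toℕ q)
      ... | tri< p<q _ _ = far-pair⇒chord
            (Crossings.far-pair K X Y (λ i → InImage? f₁ (vert C i)) covered step p q p<q ¬Xp ¬Yq)
      ... | tri> _ _ q<p = far-pair⇒chord (far-pair-swap
            (Crossings.far-pair K Y X (λ i → InImage? f₂ (vert C i)) (Sum.swap ∘ covered) (Sum.swap ∘ step)
              q p q<p ¬Yq ¬Xp))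
      ... | tri≈ _ p≡q _ with covered p
      ...   | inj₁ Xp = ⊥-elim (¬Xp Xp)
      ...   | inj₂ Yp = ⊥-elim (¬Yq (subst Y (FP.toℕ-injective p≡q) Yp))

open import Data.Integer using (ℤ; _*_)

chromatic-product : ∀ {N n₁ n₂ n : ℕ} {G : SGraph N} {G₁ : SGraph n₁} {G₂ : SGraph n₂} →
  Gluing G G₁ G₂ n → (pG p₁ p₂ pB : Poly) → IsChromPoly G pG → IsChromPoly G₁ p₁ → IsChromPoly G₂ p₂ →
  IsChromPoly (B n) pB → ∀ (t : ℤ) → evalP pG t * evalP pB t ≡ evalP p₁ t * evalP p₂ t
chromatic-product {n = n} {G} {G₁} {G₂} glue pG p₁ p₂ pB χG χ₁ χ₂ χB =
  Polynomials.products-agreeing-at-odd⇒equal pG pB p₁ p₂ at-odd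
  where
  open import Data.Nat as ℕ using (_≤_)
  open import Data.Integer using (+_)
  open import Data.Integer.Properties using (pos-*)
  open import Relation.Binary.PropositionalEquality using (cong; cong₂; sym; module ≡-Reasoning)
  open ≡-Reasoning
  at-odd : ∀ k → 1 ≤ k → evalP pG (Polynomials.odd k) * evalP pB (Polynomials.odd k)
                       ≡ evalP p₁ (Polynomials.odd k) * evalP p₂ (Polynomials.odd k)
  at-odd k 1≤k = begin
    evalP pG _ * evalP pB _                           ≡⟨ cong₂ _*_ (χG k 1≤k) (χB k 1≤k) ⟩
    + numColorings G k * + numColorings (B n) k       ≡⟨ sym (pos-* (numColorings G k) _) ⟩
    + (numColorings G k ℕ.* numColorings (B n) k)     ≡⟨ cong +_ (GluingCount.counting-identity k glue) ⟩
    + (numColorings G₁ k ℕ.* numColorings G₂ k)       ≡⟨ pos-* (numColorings G₁ k) _ ⟩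
    + numColorings G₁ k * + numColorings G₂ k         ≡⟨ sym (cong₂ _*_ (χ₁ k 1≤k) (χ₂ k 1≤k)) ⟩
    evalP p₁ _ * evalP p₂ _                           ∎

lemma4p13 : ∀ {N n₁ n₂ n : ℕ} (G : SGraph N) (G₁ : SGraph n₁) (G₂ : SGraph n₂) →
    Gluing G G₁ G₂ n →
    ((pG p₁ p₂ pB : Poly) → IsChromPoly G pG → IsChromPoly G₁ p₁ → IsChromPoly G₂ p₂ →
    IsChromPoly (B n) pB → ∀ (t : ℤ) → evalP pG t * evalP pB t ≡ evalP p₁ t * evalP p₂ t)
    × (BalancedChordal G₁ → BalancedChordal G₂ → BalancedChordal G)
lemma4p13 G G₁ G₂ glue = chromatic-product glue Data.Product., Chordality.gluing-balanced-chordal glue
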